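{- The group $\bar\Gamma_0(2)$ contains a unique conjugacy class of involutions. Let $\chi:\bar\Gamma_0(2)\to\mathbf{C}^\times$ be a character with $\chi(\bar U)$ a primitive $n$-th root of unity and $\chi(\bar V)=\varepsilon\in\{\pm1\}$; put $H=\ker\chi$, $H_0=H\cap\bar\Gamma(2)$, $H_1=H_0\langle\bar V\rangle$, $H_2=H\langle\bar V\rangle$. Then $H_1$ contains exactly $n$ conjugacy classes of involutions, and if $n$ is even and $\varepsilon=-1$, then $H_2$ contains exactly $n/2$ conjugacy classes of involutions.
   Context: $\Gamma=\mathrm{PSL}_2(\mathbf{Z})$; bars denote images in $\Gamma$; $T=\begin{pmatrix}1&1\\0&1\end{pmatrix}$, $U=\begin{pmatrix}1&0\\2&1\end{pmatrix}$, $V=TU^{ -1}=\begin{pmatrix}-1&1\\-2&1\end{pmatrix}$. Conjugacy classes are taken within the group in question. -}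

module Defs where

open import Data.Nat as ℕ using (ℕ; suc; _<_; _≤_)
open import Data.Integer as ℤ using (ℤ; +_; -[1+_])
open import Data.Integer.Divisibility using () renaming (_∣_ to _∣ℤ_)
open import Data.Rational as ℚ using (ℚ; ↧ₙ_; ½; 0ℚ)
open import Data.Fin using (Fin)
open import Data.Product using (Σ; ∃; _×_; _,_)
open import Data.Sum using (_⊎_)
open import Data.Sign using (Sign)
open import Relation.Binary.PropositionalEquality using (_≡_; _≢_)
open import Relation.Nullary using (¬_)

record M₂ : Set where
  constructor mat
  field
    a b c d : ℤ

open M₂ public

_·_ : M₂ → M₂ → M₂
x · y = mat (a x ℤ.* a y ℤ.+ b x ℤ.* c y) (a x ℤ.* b y ℤ.+ b x ℤ.* d y)
            (c x ℤ.* a y ℤ.+ d x ℤ.* c y) (c x ℤ.* b y ℤ.+ d x ℤ.* d y)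

det : M₂ → ℤ
det x = a x ℤ.* d x ℤ.- b x ℤ.* c x

neg : M₂ → M₂
neg x = mat (ℤ.- a x) (ℤ.- b x) (ℤ.- c x) (ℤ.- d x)

I₂ : M₂
I₂ = mat (+ 1) (+ 0) (+ 0) (+ 1)

-- T, U, V = T U⁻¹ from the paper
T U V : M₂
T = mat (+ 1) (+ 1) (+ 0) (+ 1)
U = mat (+ 1) (+ 0) (+ 2) (+ 1)
V = mat (ℤ.- (+ 1)) (+ 1) (ℤ.- (+ 2)) (+ 1)

-- Equality in PSL₂(ℤ): matrices agree up to sign.
-- Elements of PSL₂(ℤ) are represented by integer matrices of determinant 1.
_≈_ : M₂ → M₂ → Set
x ≈ y = (x ≡ y) ⊎ (x ≡ neg y)

-- Subsets of PSL₂(ℤ) are predicates on determinant-1 matrices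
-- (all the ones we use are invariant under x ↦ -x).

Subset : Set₁
Subset = M₂ → Set

Γ₀2 : Subset
Γ₀2 x = (det x ≡ + 1) × (+ 2 ∣ℤ c x)

Γ2 : Subset
Γ2 x = (det x ≡ + 1) × (+ 2 ∣ℤ (a x ℤ.- + 1)) × (+ 2 ∣ℤ b x)
       × (+ 2 ∣ℤ c x) × (+ 2 ∣ℤ (d x ℤ.- + 1))

-- ℚ/ℤ, identified with the group of roots of unity in ℂ^× via
-- q ↦ exp(2πiq).

IsInt : ℚ → Set
IsInt q = ↧ₙ q ≡ 1

_~_ : ℚ → ℚ → Set
p ~ q = IsInt (p ℚ.- q)

_•_ : ℕ → ℚ → ℚ
k • q = (+ k ℚ./ 1) ℚ.* q

PrimitiveRoot : ℕ → ℚ → Set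
PrimitiveRoot n q = (1 ≤ n) × IsInt (n • q) × (∀ k → 1 ≤ k → k < n → ¬ IsInt (k • q))

-- ε ∈ {±1} as an element of ℚ/ℤ: +1 ↦ 0, -1 ↦ 1/2.
signQ : Sign → ℚ
signQ Sign.+ = 0ℚ
signQ Sign.- = ½

-- A character χ : Γ̄₀(2) → μ_∞ ⊂ ℂ^×, written additively with values in ℚ/ℤ.
-- χ is a function on matrices; only its values on Γ̄₀(2) matter.
record Character : Set where
  field
    χ    : M₂ → ℚ
    resp : ∀ x y → Γ₀2 x → x ≈ y → χ x ~ χ y
    hom  : ∀ x y → Γ₀2 x → Γ₀2 y → χ (x · y) ~ (χ x ℚ.+ χ y)

open Character public

Ker : Character → Subset
Ker ψ x = Γ₀2 x × (χ ψ x ~ 0ℚ)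

_∩_ : Subset → Subset → Subset
(P ∩ Q) x = P x × Q x

-- K⟨V̄⟩ = K ∪ K V̄  (K normal in Γ̄₀(2), V̄ an involution)
withV : Subset → Subset
withV K x = ∃ λ h → K h × ((x ≈ h) ⊎ (x ≈ (h · V)))

H  : Character → Subset
H ψ = Ker ψ

H₀ : Character → Subset
H₀ ψ = H ψ ∩ Γ2

H₁ : Character → Subset
H₁ ψ = withV (H₀ ψ)

H₂ : Character → Subset
H₂ ψ = withV (H ψ)

Involution : Subset → M₂ → Set
Involution K x = K x × ¬ (x ≈ I₂) × ((x · x) ≈ I₂)

Conj : Subset → M₂ → M₂ → Set
Conj K x y = ∃ λ k → K k × ((k · x) ≈ (y · k))

InvClasses : Subset → ℕ → Set
InvClasses K m =
  Σ (Fin m → M₂) λ r →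
    (∀ i → Involution K (r i))
    × (∀ i j → i ≢ j → ¬ Conj K (r i) (r j))
    × (∀ x → Involution K x → ∃ λ i → Conj K x (r i))

-- Every involution of Γ̄₀(2) has trace zero, and Euclid's algorithm on its entry ∣a∣, run by
-- conjugating with T̄^±1 and Ū^±1, carries it to V̄. For a character ψ of Γ̄₀(2) with ψ(V̄) = 1 and
-- ψ(Ū) of exact order m, multiplying each conjugator by a power of Ū keeps it inside Ker ψ, so every
-- involution of Ker ψ is Ker ψ-conjugate to some Ū^w V̄ Ū^(-w), and w matters only modulo m. The
-- residues are distinct: an element of Ker ψ conjugating Ū^i V̄ Ū^(-i) to Ū^j V̄ Ū^(-j) yields an
-- element of the centraliser {1, V̄} of V̄, whose ψ-value ψ(Ū)^(i-j) must then be 1. So Ker ψ has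
-- exactly m classes of involutions. Γ̄₀(2) is the kernel of the trivial character (m = 1), and
-- H₁, H₂ are the kernels of χ·χ(V̄)^b and χ², with m = n and m = n/2.

module Submission where

open import Defs
open import Data.Nat using (ℕ; _/_)
open import Data.Nat.Divisibility using (_∣_)
open import Data.Product using (_×_)
open import Data.Sign using (Sign)
open import Relation.Binary.PropositionalEquality using (_≡_)

open import Data.Nat as ℕ using (zero; suc; s≤s; z≤n)
import Data.Nat.Properties as ℕP
open import Data.Integer as ℤ using (ℤ; +_; -[1+_])
import Data.Integer.Properties as ℤP
import Data.Integer.GCD
import Data.Nat.Divisibility
import Data.Nat.Tactic.RingSolver
import Data.Nat.Induction
import Data.Nat.DivMod
open import Induction.WellFounded using (Acc; acc; WfRec)
open import Data.Integer.Divisibility.Signed as ℤ∣ using (divides; ∣ᵤ⇒∣; ∣⇒∣ᵤ)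
import Data.Integer.DivMod as ℤDM
open import Data.Rational as ℚ using (ℚ; mkℚ; ↥_; ↧ₙ_; ½; 1ℚ; 0ℚ)
import Data.Rational.Properties as ℚP
open import Data.Rational.Unnormalised as ℚᵘ using (mkℚᵘ; *≡*)
import Data.Rational.Unnormalised.Properties as ℚᵘP
open import Data.Product using (∃; _,_; proj₁; proj₂)
open import Data.Fin using (Fin; toℕ; fromℕ<)
import Data.Fin.Properties as FinP
open import Data.Sum using (_⊎_; inj₁; inj₂)
open import Data.Maybe using (Maybe; just; nothing)
open import Data.Empty using (⊥-elim)
open import Relation.Nullary using (¬_; yes; no)
open import Relation.Binary.Definitions using (tri<; tri≈; tri>)
open import Relation.Binary.PropositionalEquality
  using (_≢_; refl; sym; trans; cong; cong₂; subst; subst₂; module ≡-Reasoning)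
open import Relation.Binary.Bundles using (Setoid)
open import Algebra.Bundles using (AbelianGroup)
import Algebra.Properties.AbelianGroup as AbelianGroupProperties
import Tactic.RingSolver.Core.AlmostCommutativeRing as ACR
open import Tactic.RingSolver using (solve-∀)
open import Data.Integer.Tactic.RingSolver using () renaming (ring to ℤ-ring)
open import Level using (0ℓ)

Even : ℤ → Set
Even z = + 2 ℤ∣.∣ z

Odd : ℤ → Set
Odd z = Even (z ℤ.- + 1)

parity : ∀ z → Even z ⊎ Odd z
parity z with z ℤDM.%ℕ 2 | ℤDM.n%ℕd<d z 2 | ℤDM.a≡a%ℕn+[a/ℕn]*n z 2
... | 0 | _ | z≡ = inj₁ (divides (z ℤDM./ℕ 2) (trans z≡ (ℤP.+-identityˡ _)))
... | 1 | _ | z≡ = inj₂ (divides (z ℤDM./ℕ 2) (trans (cong (ℤ._- + 1) z≡) (cancel (z ℤDM./ℕ 2))))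
  where
  cancel : ∀ q → (+ 1 ℤ.+ q ℤ.* + 2) ℤ.- + 1 ≡ q ℤ.* + 2
  cancel = solve-∀ ℤ-ring
... | suc (suc _) | s≤s (s≤s ()) | _

¬Even1 : ¬ Even (+ 1)
¬Even1 2∣1 with Data.Nat.Divisibility.∣1⇒≡1 (∣⇒∣ᵤ 2∣1)
... | ()

Even⇒¬Odd : ∀ {z} → Even z → ¬ Odd z
Even⇒¬Odd {z} ez oz = ¬Even1 (subst Even (lemma z) (ℤ∣.∣m∣n⇒∣m-n ez oz))
  where
  lemma : ∀ z → z ℤ.- (z ℤ.- + 1) ≡ + 1
  lemma = solve-∀ ℤ-ring

Even-by : ∀ {z w} → Even (z ℤ.- w) → Even w → Even z
Even-by {z} {w} 2∣z-w 2∣w = subst Even (cancel z w) (ℤ∣.∣m∣n⇒∣m+n {+ 2} {z ℤ.- w} {w} 2∣z-w 2∣w)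
  where
  cancel : ∀ z w → (z ℤ.- w) ℤ.+ w ≡ z
  cancel = solve-∀ ℤ-ring

Odd⇒Even-suc : ∀ {z} → Odd z → Even (z ℤ.+ + 1)
Odd⇒Even-suc {z} (divides t z-1≡t*2) = divides (t ℤ.+ + 1) (trans (shift z) (trans (cong (ℤ._+ + 2) z-1≡t*2) (distrib t)))
  where
  shift : ∀ z → z ℤ.+ + 1 ≡ (z ℤ.- + 1) ℤ.+ + 2
  shift = solve-∀ ℤ-ring
  distrib : ∀ t → t ℤ.* + 2 ℤ.+ + 2 ≡ (t ℤ.+ + 1) ℤ.* + 2
  distrib = solve-∀ ℤ-ring

ℚ-ring : ACR.AlmostCommutativeRing 0ℓ 0ℓ
ℚ-ring = ACR.fromCommutativeRing ℚP.+-*-commutativeRing isZero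
  where
  isZero : ∀ x → Maybe (0ℚ ≡ x)
  isZero x with 0ℚ ℚP.≟ x
  ... | yes e = just e
  ... | no _  = nothing

ι : ℤ → ℚ
ι z = z ℚ./ 1

toℚᵘ-ι : ∀ z → ℚ.toℚᵘ (ι z) ℚᵘ.≃ mkℚᵘ z 0
toℚᵘ-ι z = ℚP.toℚᵘ-fromℚᵘ (mkℚᵘ z 0)

ι-homo-+ : ∀ z w → ι (z ℤ.+ w) ≡ ι z ℚ.+ ι w
ι-homo-+ z w = ℚP.toℚᵘ-injective (begin
  ℚ.toℚᵘ (ι (z ℤ.+ w))               ≈⟨ toℚᵘ-ι (z ℤ.+ w) ⟩
  mkℚᵘ (z ℤ.+ w) 0                    ≈⟨ *≡* (lemma z w) ⟩
  mkℚᵘ z 0 ℚᵘ.+ mkℚᵘ w 0              ≈⟨ ℚᵘP.+-cong (toℚᵘ-ι z) (toℚᵘ-ι w) ⟨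
  ℚ.toℚᵘ (ι z) ℚᵘ.+ ℚ.toℚᵘ (ι w)      ≈⟨ ℚP.toℚᵘ-homo-+ (ι z) (ι w) ⟨
  ℚ.toℚᵘ (ι z ℚ.+ ι w)                ∎)
  where
  open import Relation.Binary.Reasoning.Setoid ℚᵘP.≃-setoid
  lemma : ∀ z w → (z ℤ.+ w) ℤ.* + 1 ≡ (z ℤ.* + 1 ℤ.+ w ℤ.* + 1) ℤ.* + 1
  lemma = solve-∀ ℤ-ring

ι-homo-* : ∀ z w → ι (z ℤ.* w) ≡ ι z ℚ.* ι w
ι-homo-* z w = ℚP.toℚᵘ-injective (begin
  ℚ.toℚᵘ (ι (z ℤ.* w))               ≈⟨ toℚᵘ-ι (z ℤ.* w) ⟩
  mkℚᵘ (z ℤ.* w) 0                    ≈⟨ *≡* refl ⟩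
  mkℚᵘ z 0 ℚᵘ.* mkℚᵘ w 0              ≈⟨ ℚᵘP.*-cong (toℚᵘ-ι z) (toℚᵘ-ι w) ⟨
  ℚ.toℚᵘ (ι z) ℚᵘ.* ℚ.toℚᵘ (ι w)      ≈⟨ ℚP.toℚᵘ-homo-* (ι z) (ι w) ⟨
  ℚ.toℚᵘ (ι z ℚ.* ι w)                ∎)
  where open import Relation.Binary.Reasoning.Setoid ℚᵘP.≃-setoid

ι-homo-neg : ∀ z → ι (ℤ.- z) ≡ ℚ.- ι z
ι-homo-neg z = ℚP.toℚᵘ-injective (ℚᵘP.≃-trans (toℚᵘ-ι (ℤ.- z))
  (ℚᵘP.≃-sym (ℚᵘP.≃-trans (ℚP.toℚᵘ-homo‿- (ι z)) (ℚᵘP.-‿cong (toℚᵘ-ι z)))))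

IsInt-ι : ∀ z → IsInt (ι z)
IsInt-ι z = ℕP.m*n≡1⇒m≡1 (↧ₙ ι z) ℤ.∣ g ∣ (trans (sym (ℤP.abs-* (ℚ.↧ ι z) g)) (cong ℤ.∣_∣ (ℚP.↧-/ z 1)))
  where
  g : ℤ
  g = Data.Integer.GCD.gcd z (+ 1)

IsInt⇒≡ι : ∀ p → IsInt p → p ≡ ι (↥ p)
IsInt⇒≡ι p@(mkℚ _ _ _) refl = sym (ℚP.↥p/↧p≡p p)

IsInt-+ : ∀ p q → IsInt p → IsInt q → IsInt (p ℚ.+ q)
IsInt-+ p q p-int q-int =
  subst IsInt (sym (trans (cong₂ ℚ._+_ (IsInt⇒≡ι p p-int) (IsInt⇒≡ι q q-int)) (sym (ι-homo-+ (↥ p) (↥ q)))))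
    (IsInt-ι (↥ p ℤ.+ ↥ q))

IsInt-neg : ∀ p → IsInt p → IsInt (ℚ.- p)
IsInt-neg p p-int = subst IsInt (trans (ι-homo-neg (↥ p)) (cong ℚ.-_ (sym (IsInt⇒≡ι p p-int)))) (IsInt-ι (ℤ.- ↥ p))

-- Equality in ℚ/ℤ; the record keeps both sides inferable, which Defs._~_ does not.
infix 4 _≋_
record _≋_ (p q : ℚ) : Set where
  constructor ⟨_⟩
  field unwrap : p ~ q
open _≋_

≡⇒≋ : ∀ {p q} → p ≡ q → p ≋ q
≡⇒≋ {p} refl = ⟨ subst IsInt (sym (ℚP.+-inverseʳ p)) refl ⟩

IsInt⇒≋0 : ∀ {p} → IsInt p → p ≋ 0ℚ
IsInt⇒≋0 {p} i = ⟨ subst IsInt (sym (ℚP.+-identityʳ p)) i ⟩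

≋0⇒IsInt : ∀ {p} → p ≋ 0ℚ → IsInt p
≋0⇒IsInt {p} ⟨ i ⟩ = subst IsInt (ℚP.+-identityʳ p) i

module _ where
  private
    sym-diff : ∀ p q → ℚ.- (p ℚ.- q) ≡ q ℚ.- p
    sym-diff = solve-∀ ℚ-ring
    trans-diff : ∀ p q r → (p ℚ.- q) ℚ.+ (q ℚ.- r) ≡ p ℚ.- r
    trans-diff = solve-∀ ℚ-ring
    +-diff : ∀ p p' q q' → (p ℚ.- p') ℚ.+ (q ℚ.- q') ≡ (p ℚ.+ q) ℚ.- (p' ℚ.+ q')
    +-diff = solve-∀ ℚ-ring
    neg-diff : ∀ p q → ℚ.- (p ℚ.- q) ≡ (ℚ.- p) ℚ.- (ℚ.- q)
    neg-diff = solve-∀ ℚ-ring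

  ≋-sym : ∀ {p q} → p ≋ q → q ≋ p
  ≋-sym {p} {q} ⟨ i ⟩ = ⟨ subst IsInt (sym-diff p q) (IsInt-neg (p ℚ.- q) i) ⟩

  ≋-trans : ∀ {p q r} → p ≋ q → q ≋ r → p ≋ r
  ≋-trans {p} {q} {r} ⟨ i ⟩ ⟨ j ⟩ = ⟨ subst IsInt (trans-diff p q r) (IsInt-+ (p ℚ.- q) (q ℚ.- r) i j) ⟩

  +-cong : ∀ {p p' q q'} → p ≋ p' → q ≋ q' → p ℚ.+ q ≋ p' ℚ.+ q'
  +-cong {p} {p'} {q} {q'} ⟨ i ⟩ ⟨ j ⟩ = ⟨ subst IsInt (+-diff p p' q q') (IsInt-+ (p ℚ.- p') (q ℚ.- q') i j) ⟩

  +-congˡ : ∀ p {q q'} → q ≋ q' → p ℚ.+ q ≋ p ℚ.+ q'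
  +-congˡ p = +-cong (≡⇒≋ {p} refl)

  +-congʳ : ∀ q {p p'} → p ≋ p' → p ℚ.+ q ≋ p' ℚ.+ q
  +-congʳ q p≋p' = +-cong p≋p' (≡⇒≋ {q} refl)

  neg-cong : ∀ {p q} → p ≋ q → ℚ.- p ≋ ℚ.- q
  neg-cong {p} {q} ⟨ i ⟩ = ⟨ subst IsInt (neg-diff p q) (IsInt-neg (p ℚ.- q) i) ⟩

ℚ/ℤ : AbelianGroup 0ℓ 0ℓ
ℚ/ℤ = record
  { Carrier = ℚ ; _≈_ = _≋_ ; _∙_ = ℚ._+_ ; ε = 0ℚ ; _⁻¹ = ℚ.-_
  ; isAbelianGroup = record
    { isGroup = record
      { isMonoid = record
        { isSemigroup = record
          { isMagma = record
            { isEquivalence = record { refl = ≡⇒≋ refl ; sym = ≋-sym ; trans = ≋-trans }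
            ; ∙-cong = +-cong }
          ; assoc = λ p q r → ≡⇒≋ (ℚP.+-assoc p q r) }
        ; identity = (λ p → ≡⇒≋ (ℚP.+-identityˡ p)) , (λ p → ≡⇒≋ (ℚP.+-identityʳ p)) }
      ; inverse = (λ p → ≡⇒≋ (ℚP.+-inverseˡ p)) , (λ p → ≡⇒≋ (ℚP.+-inverseʳ p))
      ; ⁻¹-cong = neg-cong }
    ; comm = λ p q → ≡⇒≋ (ℚP.+-comm p q) } }

module ℚ/ℤ where
  open AbelianGroup ℚ/ℤ public using (setoid)
  open AbelianGroupProperties ℚ/ℤ public using (identityʳ-unique; inverseˡ-unique; x∙y⁻¹≈ε⇒x≈y)

-- Defs' k • q is definitionally (+ k) ⊙ q.
infixr 8 _⊙_
_⊙_ : ℤ → ℚ → ℚ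
z ⊙ q = ι z ℚ.* q

⊙-homo-+ : ∀ z w q → (z ℤ.+ w) ⊙ q ≡ z ⊙ q ℚ.+ w ⊙ q
⊙-homo-+ z w q = trans (cong (ℚ._* q) (ι-homo-+ z w)) (ℚP.*-distribʳ-+ q (ι z) (ι w))

⊙-assoc : ∀ z w q → (z ℤ.* w) ⊙ q ≡ z ⊙ w ⊙ q
⊙-assoc z w q = trans (cong (ℚ._* q) (ι-homo-* z w)) (ℚP.*-assoc (ι z) (ι w) q)

⊙-neg : ∀ z q → (ℤ.- z) ⊙ q ≡ ℚ.- (z ⊙ q)
⊙-neg z q = trans (cong (ℚ._* q) (ι-homo-neg z)) (sym (ℚP.neg-distribˡ-* (ι z) q))

IsInt-⊙ : ∀ z q → IsInt q → IsInt (z ⊙ q)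
IsInt-⊙ z q q-int = subst IsInt (trans (ι-homo-* z (↥ q)) (cong (ι z ℚ.*_) (sym (IsInt⇒≡ι q q-int)))) (IsInt-ι (z ℤ.* ↥ q))

⊙-congʳ : ∀ z {p q} → p ≋ q → z ⊙ p ≋ z ⊙ q
⊙-congʳ z {p} {q} ⟨ i ⟩ = ⟨ subst IsInt (distrib (ι z) p q) (IsInt-⊙ z (p ℚ.- q) i) ⟩
  where
  distrib : ∀ x p q → x ℚ.* (p ℚ.- q) ≡ x ℚ.* p ℚ.- x ℚ.* q
  distrib = solve-∀ ℚ-ring

⊙-two : ∀ q → (+ 2) ⊙ q ≡ q ℚ.+ q
⊙-two q = trans (cong (ℚ._* q) (ι-homo-+ (+ 1) (+ 1))) (distrib q)
  where
  distrib : ∀ q → (1ℚ ℚ.+ 1ℚ) ℚ.* q ≡ q ℚ.+ q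
  distrib = solve-∀ ℚ-ring

⊙-mod2 : ∀ {q} z w → q ℚ.+ q ≋ 0ℚ → Even (z ℤ.- w) → z ⊙ q ≋ w ⊙ q
⊙-mod2 {q} z w 2q≋0 (divides t z-w≡t*2) = ℚ/ℤ.x∙y⁻¹≈ε⇒x≈y (z ⊙ q) (w ⊙ q) (begin
  z ⊙ q ℚ.+ ℚ.- (w ⊙ q)     ≡⟨ cong (z ⊙ q ℚ.+_) (⊙-neg w q) ⟨
  z ⊙ q ℚ.+ (ℤ.- w) ⊙ q     ≡⟨ ⊙-homo-+ z (ℤ.- w) q ⟨
  (z ℤ.- w) ⊙ q             ≡⟨ cong (_⊙ q) z-w≡t*2 ⟩
  (t ℤ.* + 2) ⊙ q           ≡⟨ ⊙-assoc t (+ 2) q ⟩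
  t ⊙ (+ 2) ⊙ q             ≡⟨ cong (t ⊙_) (⊙-two q) ⟩
  t ⊙ (q ℚ.+ q)             ≈⟨ ⊙-congʳ t 2q≋0 ⟩
  t ⊙ 0ℚ                    ≡⟨ ℚP.*-zeroʳ (ι t) ⟩
  0ℚ                        ∎)
  where open import Relation.Binary.Reasoning.Setoid ℚ/ℤ.setoid

⊙-even : ∀ {q} z → q ℚ.+ q ≋ 0ℚ → Even z → z ⊙ q ≋ 0ℚ
⊙-even {q} z 2q≋0 2∣z = ≋-trans (⊙-mod2 z (+ 0) 2q≋0 (subst Even (sym (ℤP.+-identityʳ z)) 2∣z)) (≡⇒≋ (ℚP.*-zeroˡ q))

2-torsion : ∀ q → q ℚ.+ q ≋ 0ℚ → q ≋ 0ℚ ⊎ q ≋ ½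
2-torsion q 2q≋0 = by-parity (parity z)
  where
  open ≡-Reasoning
  z : ℤ
  z = ↥ (q ℚ.+ q)
  halve : ∀ q → q ≡ (q ℚ.+ q) ℚ.* ½
  halve = solve-∀ ℚ-ring
  q≡z/2 : q ≡ ι z ℚ.* ½
  q≡z/2 = trans (halve q) (cong (ℚ._* ½) (IsInt⇒≡ι (q ℚ.+ q) (≋0⇒IsInt 2q≋0)))
  by-parity : Even z ⊎ Odd z → q ≋ 0ℚ ⊎ q ≋ ½
  by-parity (inj₁ (divides t z≡t*2)) = inj₁ (IsInt⇒≋0 (subst IsInt (sym q≡ιt) (IsInt-ι t)))
    where
    double : ∀ t → t ℤ.* + 2 ≡ t ℤ.+ t
    double = solve-∀ ℤ-ring
    q≡ιt : q ≡ ι t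
    q≡ιt = begin
      q                        ≡⟨ q≡z/2 ⟩
      ι z ℚ.* ½                ≡⟨ cong (λ z → ι z ℚ.* ½) (trans z≡t*2 (double t)) ⟩
      ι (t ℤ.+ t) ℚ.* ½        ≡⟨ cong (ℚ._* ½) (ι-homo-+ t t) ⟩
      (ι t ℚ.+ ι t) ℚ.* ½      ≡⟨ halve (ι t) ⟨
      ι t                      ∎
  by-parity (inj₂ (divides t z-1≡t*2)) = inj₂ ⟨ subst IsInt (sym q-½≡ιt) (IsInt-ι t) ⟩
    where
    double : ∀ z t → z ℤ.- + 1 ≡ t ℤ.* + 2 → z ≡ (t ℤ.+ t) ℤ.+ + 1
    double z t e = trans (shift z) (trans (cong (ℤ._+ + 1) e) (distrib t))
      where
      shift : ∀ z → z ≡ (z ℤ.- + 1) ℤ.+ + 1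
      shift = solve-∀ ℤ-ring
      distrib : ∀ t → t ℤ.* + 2 ℤ.+ + 1 ≡ (t ℤ.+ t) ℤ.+ + 1
      distrib = solve-∀ ℤ-ring
    halve-odd : ∀ p → ((p ℚ.+ p) ℚ.+ 1ℚ) ℚ.* ½ ℚ.- ½ ≡ p
    halve-odd = solve-∀ ℚ-ring
    q-½≡ιt : q ℚ.- ½ ≡ ι t
    q-½≡ιt = begin
      q ℚ.- ½                                ≡⟨ cong (ℚ._- ½) q≡z/2 ⟩
      ι z ℚ.* ½ ℚ.- ½                        ≡⟨ cong (λ z → ι z ℚ.* ½ ℚ.- ½) (double z t z-1≡t*2) ⟩
      ι ((t ℤ.+ t) ℤ.+ + 1) ℚ.* ½ ℚ.- ½      ≡⟨ cong (λ p → p ℚ.* ½ ℚ.- ½) (ι-homo-+ (t ℤ.+ t) (+ 1)) ⟩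
      (ι (t ℤ.+ t) ℚ.+ 1ℚ) ℚ.* ½ ℚ.- ½       ≡⟨ cong (λ p → (p ℚ.+ 1ℚ) ℚ.* ½ ℚ.- ½) (ι-homo-+ t t) ⟩
      ((ι t ℚ.+ ι t) ℚ.+ 1ℚ) ℚ.* ½ ℚ.- ½     ≡⟨ halve-odd (ι t) ⟩
      ι t                                    ∎

PrimitiveRoot-resp : ∀ {m p q} → PrimitiveRoot m p → p ≋ q → PrimitiveRoot m q
PrimitiveRoot-resp {m} {p} {q} (1≤m , mp-int , minimal) p≋q =
  1≤m ,
  ≋0⇒IsInt (≋-trans (⊙-congʳ (+ m) (≋-sym p≋q)) (IsInt⇒≋0 mp-int)) ,
  λ k 1≤k k<m kq-int → minimal k 1≤k k<m (≋0⇒IsInt (≋-trans (⊙-congʳ (+ k) p≋q) (IsInt⇒≋0 kq-int)))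

PrimitiveRoot-double : ∀ k q → PrimitiveRoot (k ℕ.* 2) q → PrimitiveRoot k (q ℚ.+ q)
PrimitiveRoot-double zero q (() , _ , _)
PrimitiveRoot-double k@(suc _) q (_ , 2kq-int , minimal) =
  s≤s z≤n ,
  subst IsInt (double k) 2kq-int ,
  λ j 1≤j j<k 2jq-int → minimal (j ℕ.* 2) (ℕP.≤-trans 1≤j (ℕP.m≤m*n j 2)) (ℕP.*-monoˡ-< 2 j<k)
                          (subst IsInt (sym (double j)) 2jq-int)
  where
  double : ∀ n → (+ (n ℕ.* 2)) ⊙ q ≡ (+ n) ⊙ (q ℚ.+ q)
  double n = trans (cong (_⊙ q) (ℤP.pos-* n 2)) (trans (⊙-assoc (+ n) (+ 2) q) (cong ((+ n) ⊙_) (⊙-two q)))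

PrimitiveRoot-separates : ∀ {m q i j} → PrimitiveRoot m q → i ℕ.< j → j ℕ.< m → ¬ ((+ i) ⊙ q ≋ (+ j) ⊙ q)
PrimitiveRoot-separates {q = q} {i} {j} (_ , _ , minimal) i<j j<m i≋j =
  minimal (j ℕ.∸ i) (ℕP.m<n⇒0<n∸m i<j) (ℕP.≤-<-trans (ℕP.m∸n≤m j i) j<m)
    (≋0⇒IsInt (ℚ/ℤ.identityʳ-unique ((+ i) ⊙ q) _ (≋-sym (≋-trans i≋j (≡⇒≋ split)))))
  where
  split : (+ j) ⊙ q ≡ (+ i) ⊙ q ℚ.+ (+ (j ℕ.∸ i)) ⊙ q
  split = trans (cong (λ n → (+ n) ⊙ q) (sym (ℕP.m+[n∸m]≡n (ℕP.<⇒≤ i<j)))) (⊙-homo-+ (+ i) (+ (j ℕ.∸ i)) q)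

PrimitiveRoot-injective : ∀ {m q i j} → PrimitiveRoot m q → i ℕ.< m → j ℕ.< m → (+ i) ⊙ q ≋ (+ j) ⊙ q → i ≡ j
PrimitiveRoot-injective {i = i} {j} prim i<m j<m i≋j with ℕP.<-cmp i j
... | tri< i<j _ _ = ⊥-elim (PrimitiveRoot-separates prim i<j j<m i≋j)
... | tri≈ _ i≡j _ = i≡j
... | tri> _ _ j<i = ⊥-elim (PrimitiveRoot-separates prim j<i i<m (≋-sym i≋j))

mat-cong : ∀ {a b c d a' b' c' d'} → a ≡ a' → b ≡ b' → c ≡ c' → d ≡ d' → mat a b c d ≡ mat a' b' c' d'
mat-cong refl refl refl refl = refl

module _ where
  private
    assoc : ∀ a b e f g h s t →
      (a ℤ.* e ℤ.+ b ℤ.* g) ℤ.* s ℤ.+ (a ℤ.* f ℤ.+ b ℤ.* h) ℤ.* t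
        ≡ a ℤ.* (e ℤ.* s ℤ.+ f ℤ.* t) ℤ.+ b ℤ.* (g ℤ.* s ℤ.+ h ℤ.* t)
    assoc = solve-∀ ℤ-ring
    negˡ : ∀ a b e g → (ℤ.- a) ℤ.* e ℤ.+ (ℤ.- b) ℤ.* g ≡ ℤ.- (a ℤ.* e ℤ.+ b ℤ.* g)
    negˡ = solve-∀ ℤ-ring
    negʳ : ∀ a b e g → a ℤ.* (ℤ.- e) ℤ.+ b ℤ.* (ℤ.- g) ≡ ℤ.- (a ℤ.* e ℤ.+ b ℤ.* g)
    negʳ = solve-∀ ℤ-ring
    det-mult : ∀ a b c d e f g h →
      (a ℤ.* e ℤ.+ b ℤ.* g) ℤ.* (c ℤ.* f ℤ.+ d ℤ.* h) ℤ.- (a ℤ.* f ℤ.+ b ℤ.* h) ℤ.* (c ℤ.* e ℤ.+ d ℤ.* g)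
        ≡ (a ℤ.* d ℤ.- b ℤ.* c) ℤ.* (e ℤ.* h ℤ.- f ℤ.* g)
    det-mult = solve-∀ ℤ-ring
    det-negation : ∀ a b c d → (ℤ.- a) ℤ.* (ℤ.- d) ℤ.- (ℤ.- b) ℤ.* (ℤ.- c) ≡ a ℤ.* d ℤ.- b ℤ.* c
    det-negation = solve-∀ ℤ-ring
    unit₁ : ∀ a c → + 1 ℤ.* a ℤ.+ + 0 ℤ.* c ≡ a
    unit₁ = solve-∀ ℤ-ring
    unit₂ : ∀ a c → + 0 ℤ.* a ℤ.+ + 1 ℤ.* c ≡ c
    unit₂ = solve-∀ ℤ-ring
    unit₃ : ∀ a b → a ℤ.* + 1 ℤ.+ b ℤ.* + 0 ≡ a
    unit₃ = solve-∀ ℤ-ring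
    unit₄ : ∀ a b → a ℤ.* + 0 ℤ.+ b ℤ.* + 1 ≡ b
    unit₄ = solve-∀ ℤ-ring

  ·-assoc : ∀ x y z → (x · y) · z ≡ x · (y · z)
  ·-assoc (mat a b c d) (mat e f g h) (mat s t u v) =
    mat-cong (assoc a b e f g h s u) (assoc a b e f g h t v) (assoc c d e f g h s u) (assoc c d e f g h t v)

  ·-identityˡ : ∀ x → I₂ · x ≡ x
  ·-identityˡ (mat a b c d) = mat-cong (unit₁ a c) (unit₁ b d) (unit₂ a c) (unit₂ b d)

  ·-identityʳ : ∀ x → x · I₂ ≡ x
  ·-identityʳ (mat a b c d) = mat-cong (unit₃ a b) (unit₄ a b) (unit₃ c d) (unit₄ c d)

  ·-negˡ : ∀ x y → neg x · y ≡ neg (x · y)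
  ·-negˡ (mat a b c d) (mat e f g h) = mat-cong (negˡ a b e g) (negˡ a b f h) (negˡ c d e g) (negˡ c d f h)

  ·-negʳ : ∀ x y → x · neg y ≡ neg (x · y)
  ·-negʳ (mat a b c d) (mat e f g h) = mat-cong (negʳ a b e g) (negʳ a b f h) (negʳ c d e g) (negʳ c d f h)

  neg-involutive : ∀ x → neg (neg x) ≡ x
  neg-involutive (mat a b c d) =
    mat-cong (ℤP.neg-involutive a) (ℤP.neg-involutive b) (ℤP.neg-involutive c) (ℤP.neg-involutive d)

  det-· : ∀ x y → det (x · y) ≡ det x ℤ.* det y
  det-· (mat a b c d) (mat e f g h) = det-mult a b c d e f g h

  det-neg : ∀ x → det (neg x) ≡ det x
  det-neg (mat a b c d) = det-negation a b c d

adj : M₂ → M₂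
adj (mat a b c d) = mat d (ℤ.- b) (ℤ.- c) a

module _ where
  private
    adj-a : ∀ a b c d → a ℤ.* d ℤ.+ b ℤ.* (ℤ.- c) ≡ a ℤ.* d ℤ.- b ℤ.* c
    adj-a = solve-∀ ℤ-ring
    adj-b : ∀ a b → a ℤ.* (ℤ.- b) ℤ.+ b ℤ.* a ≡ + 0
    adj-b = solve-∀ ℤ-ring
    adj-c : ∀ c d → c ℤ.* d ℤ.+ d ℤ.* (ℤ.- c) ≡ + 0
    adj-c = solve-∀ ℤ-ring
    adj-d : ∀ a b c d → c ℤ.* (ℤ.- b) ℤ.+ d ℤ.* a ≡ a ℤ.* d ℤ.- b ℤ.* c
    adj-d = solve-∀ ℤ-ring
    adj-a' : ∀ a b c d → d ℤ.* a ℤ.+ (ℤ.- b) ℤ.* c ≡ a ℤ.* d ℤ.- b ℤ.* c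
    adj-a' = solve-∀ ℤ-ring
    adj-b' : ∀ b d → d ℤ.* b ℤ.+ (ℤ.- b) ℤ.* d ≡ + 0
    adj-b' = solve-∀ ℤ-ring
    adj-c' : ∀ a c → (ℤ.- c) ℤ.* a ℤ.+ a ℤ.* c ≡ + 0
    adj-c' = solve-∀ ℤ-ring
    adj-d' : ∀ a b c d → (ℤ.- c) ℤ.* b ℤ.+ a ℤ.* d ≡ a ℤ.* d ℤ.- b ℤ.* c
    adj-d' = solve-∀ ℤ-ring
    det-adjugate : ∀ a b c d → d ℤ.* a ℤ.- (ℤ.- b) ℤ.* (ℤ.- c) ≡ a ℤ.* d ℤ.- b ℤ.* c
    det-adjugate = solve-∀ ℤ-ring

  ·-adjʳ : ∀ x → det x ≡ + 1 → x · adj x ≡ I₂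
  ·-adjʳ (mat a b c d) det≡1 =
    mat-cong (trans (adj-a a b c d) det≡1) (adj-b a b) (adj-c c d) (trans (adj-d a b c d) det≡1)

  ·-adjˡ : ∀ x → det x ≡ + 1 → adj x · x ≡ I₂
  ·-adjˡ (mat a b c d) det≡1 =
    mat-cong (trans (adj-a' a b c d) det≡1) (adj-b' b d) (adj-c' a c) (trans (adj-d' a b c d) det≡1)

  det-adj : ∀ x → det (adj x) ≡ det x
  det-adj (mat a b c d) = det-adjugate a b c d

-- Equality in PSL₂(ℤ), wrapped for the same reason as _≋_.
infix 4 _≅_
record _≅_ (x y : M₂) : Set where
  constructor ⟪_⟫
  field unwrap : x ≈ y
open _≅_

≅-refl : ∀ {x} → x ≅ x
≅-refl = ⟪ inj₁ refl ⟫

≡⇒≅ : ∀ {x y} → x ≡ y → x ≅ y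
≡⇒≅ refl = ≅-refl

neg-≅ : ∀ x → neg x ≅ x
neg-≅ x = ⟪ inj₂ refl ⟫

≅-sym : ∀ {x y} → x ≅ y → y ≅ x
≅-sym ⟪ inj₁ refl ⟫ = ≅-refl
≅-sym {y = y} ⟪ inj₂ refl ⟫ = ⟪ inj₂ (sym (neg-involutive y)) ⟫

≅-trans : ∀ {x y z} → x ≅ y → y ≅ z → x ≅ z
≅-trans ⟪ inj₁ refl ⟫ q = q
≅-trans ⟪ inj₂ refl ⟫ ⟪ inj₁ refl ⟫ = ⟪ inj₂ refl ⟫
≅-trans {z = z} ⟪ inj₂ refl ⟫ ⟪ inj₂ refl ⟫ = ⟪ inj₁ (neg-involutive z) ⟫

≅-setoid : Setoid 0ℓ 0ℓ
≅-setoid = record { Carrier = M₂ ; _≈_ = _≅_ ; isEquivalence = record { refl = ≅-refl ; sym = ≅-sym ; trans = ≅-trans } }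

·-congˡ : ∀ z {x y} → x ≅ y → z · x ≅ z · y
·-congˡ z ⟪ inj₁ refl ⟫ = ≅-refl
·-congˡ z {y = y} ⟪ inj₂ refl ⟫ = ⟪ inj₂ (·-negʳ z y) ⟫

·-congʳ : ∀ z {x y} → x ≅ y → x · z ≅ y · z
·-congʳ z ⟪ inj₁ refl ⟫ = ≅-refl
·-congʳ z {y = y} ⟪ inj₂ refl ⟫ = ⟪ inj₂ (·-negˡ y z) ⟫

mkΓ₀2 : ∀ {x} → det x ≡ + 1 → Even (c x) → Γ₀2 x
mkΓ₀2 {x} det≡1 2∣c = det≡1 , ∣⇒∣ᵤ {+ 2} {c x} 2∣c

Γ₀2⇒Even-c : ∀ {x} → Γ₀2 x → Even (c x)
Γ₀2⇒Even-c {x} (_ , 2∣c) = ∣ᵤ⇒∣ {+ 2} {c x} 2∣c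

Γ₀2-· : ∀ x y → Γ₀2 x → Γ₀2 y → Γ₀2 (x · y)
Γ₀2-· x y Γx@(det-x , _) Γy@(det-y , _) = mkΓ₀2 {x · y}
  (trans (det-· x y) (cong₂ ℤ._*_ det-x det-y))
  (ℤ∣.∣m∣n⇒∣m+n {+ 2} {c x ℤ.* a y} {d x ℤ.* c y}
    (ℤ∣.∣m⇒∣m*n (a y) (Γ₀2⇒Even-c {x} Γx)) (ℤ∣.∣n⇒∣m*n (d x) (Γ₀2⇒Even-c {y} Γy)))

Γ₀2-adj : ∀ x → Γ₀2 x → Γ₀2 (adj x)
Γ₀2-adj x Γx@(det-x , _) = mkΓ₀2 {adj x} (trans (det-adj x) det-x) (ℤ∣.∣m⇒∣-m {+ 2} {c x} (Γ₀2⇒Even-c {x} Γx))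

Γ₀2-resp-≅ : ∀ {x y} → Γ₀2 x → x ≅ y → Γ₀2 y
Γ₀2-resp-≅ Γx ⟪ inj₁ refl ⟫ = Γx
Γ₀2-resp-≅ {y = y} Γx@(det-x , _) ⟪ inj₂ refl ⟫ = mkΓ₀2 {y}
  (trans (sym (det-neg y)) det-x)
  (subst Even (ℤP.neg-involutive (c y)) (ℤ∣.∣m⇒∣-m {+ 2} {ℤ.- c y} (Γ₀2⇒Even-c {neg y} Γx)))

Γ₀2-I : Γ₀2 I₂
Γ₀2-I = mkΓ₀2 {I₂} refl (divides (+ 0) refl)

Γ₀2-T : Γ₀2 T
Γ₀2-T = mkΓ₀2 {T} refl (divides (+ 0) refl)

Γ₀2-U : Γ₀2 U
Γ₀2-U = mkΓ₀2 {U} refl (divides (+ 1) refl)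

Γ₀2-V : Γ₀2 V
Γ₀2-V = mkΓ₀2 {V} refl (divides -[1+ 0 ] refl)

Γ₀2⇒Odd-ad : ∀ x → Γ₀2 x → Odd (a x ℤ.* d x)
Γ₀2⇒Odd-ad x@(mat a b c d) Γx@(det≡1 , _) =
  subst Even (sym (trans (isolate a b c d) (cong (λ z → z ℤ.- + 1 ℤ.+ b ℤ.* c) det≡1)))
    (subst Even (sym (cancel (b ℤ.* c))) (ℤ∣.∣n⇒∣m*n b (Γ₀2⇒Even-c {x} Γx)))
  where
  isolate : ∀ a b c d → a ℤ.* d ℤ.- + 1 ≡ (a ℤ.* d ℤ.- b ℤ.* c) ℤ.- + 1 ℤ.+ b ℤ.* c
  isolate = solve-∀ ℤ-ring
  cancel : ∀ z → + 1 ℤ.- + 1 ℤ.+ z ≡ z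
  cancel = solve-∀ ℤ-ring

Γ₀2⇒Odd-a : ∀ x → Γ₀2 x → Odd (a x)
Γ₀2⇒Odd-a x Γx with parity (a x)
... | inj₂ odd = odd
... | inj₁ even = ⊥-elim (Even⇒¬Odd (ℤ∣.∣m⇒∣m*n (d x) even) (Γ₀2⇒Odd-ad x Γx))

Γ₀2⇒Odd-d : ∀ x → Γ₀2 x → Odd (d x)
Γ₀2⇒Odd-d x Γx with parity (d x)
... | inj₂ odd = odd
... | inj₁ even = ⊥-elim (Even⇒¬Odd (ℤ∣.∣n⇒∣m*n (a x) even) (Γ₀2⇒Odd-ad x Γx))

b-·-mod2 : ∀ x y → Γ₀2 x → Γ₀2 y → Even (b (x · y) ℤ.- (b x ℤ.+ b y))
b-·-mod2 x y Γx Γy = subst Even (sym (regroup (a x) (b x) (b y) (d y)))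
  (ℤ∣.∣m∣n⇒∣m+n {+ 2} {(a x ℤ.- + 1) ℤ.* b y} {b x ℤ.* (d y ℤ.- + 1)}
    (ℤ∣.∣m⇒∣m*n (b y) (Γ₀2⇒Odd-a x Γx)) (ℤ∣.∣n⇒∣m*n (b x) (Γ₀2⇒Odd-d y Γy)))
  where
  regroup : ∀ ax bx by dy → (ax ℤ.* by ℤ.+ bx ℤ.* dy) ℤ.- (bx ℤ.+ by) ≡ (ax ℤ.- + 1) ℤ.* by ℤ.+ bx ℤ.* (dy ℤ.- + 1)
  regroup = solve-∀ ℤ-ring

Γ₀2∧Even-b⇒Γ2 : ∀ x → Γ₀2 x → Even (b x) → Γ2 x
Γ₀2∧Even-b⇒Γ2 x Γx@(det≡1 , 2∣c) 2∣b =
  det≡1 , ∣⇒∣ᵤ {+ 2} {a x ℤ.- + 1} (Γ₀2⇒Odd-a x Γx) , ∣⇒∣ᵤ {+ 2} {b x} 2∣b , 2∣c ,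
  ∣⇒∣ᵤ {+ 2} {d x ℤ.- + 1} (Γ₀2⇒Odd-d x Γx)

Γ2⇒Even-b : ∀ x → Γ2 x → Even (b x)
Γ2⇒Even-b x (_ , _ , 2∣b , _) = ∣ᵤ⇒∣ {+ 2} {b x} 2∣b

record Intertwines (g x y : M₂) : Set where
  constructor intertwines
  field intertwining : g · x ≅ y · g
open Intertwines

module _ where
  open import Relation.Binary.Reasoning.Setoid ≅-setoid

  intertwines-· : ∀ {g h x y z} → Intertwines g x y → Intertwines h y z → Intertwines (h · g) x z
  intertwines-· {g} {h} {x} {y} {z} (intertwines gx≅yg) (intertwines hy≅zh) = intertwines (begin
    (h · g) · x   ≡⟨ ·-assoc h g x ⟩
    h · (g · x)   ≈⟨ ·-congˡ h gx≅yg ⟩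
    h · (y · g)   ≡⟨ ·-assoc h y g ⟨
    (h · y) · g   ≈⟨ ·-congʳ g hy≅zh ⟩
    (z · h) · g   ≡⟨ ·-assoc z h g ⟩
    z · (h · g)   ∎)

  intertwines-square : ∀ {g x y} → Intertwines g x y → Intertwines g (x · x) (y · y)
  intertwines-square {g} {x} {y} (intertwines gx≅yg) = intertwines (begin
    g · (x · x)   ≡⟨ ·-assoc g x x ⟨
    (g · x) · x   ≈⟨ ·-congʳ x gx≅yg ⟩
    (y · g) · x   ≡⟨ ·-assoc y g x ⟩
    y · (g · x)   ≈⟨ ·-congˡ y gx≅yg ⟩
    y · (y · g)   ≡⟨ ·-assoc y y g ⟨
    (y · y) · g   ∎)

  intertwines-I : ∀ {g y} → det g ≡ + 1 → Intertwines g I₂ y → y ≅ I₂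
  intertwines-I {g} {y} det≡1 (intertwines g≅yg) = begin
    y                    ≡⟨ ·-identityʳ y ⟨
    y · I₂               ≡⟨ cong (y ·_) (·-adjʳ g det≡1) ⟨
    y · (g · adj g)      ≡⟨ ·-assoc y g (adj g) ⟨
    (y · g) · adj g      ≈⟨ ·-congʳ (adj g) g≅yg ⟨
    (g · I₂) · adj g     ≡⟨ cong (_· adj g) (·-identityʳ g) ⟩
    g · adj g            ≡⟨ ·-adjʳ g det≡1 ⟩
    I₂                   ∎

conj : M₂ → M₂ → M₂
conj g x = (g · x) · adj g

intertwines-conj : ∀ g x → det g ≡ + 1 → Intertwines g x (conj g x)
intertwines-conj g x det≡1 = intertwines (≡⇒≅ (begin
  g · x                   ≡⟨ ·-identityʳ (g · x) ⟨
  (g · x) · I₂            ≡⟨ cong ((g · x) ·_) (·-adjˡ g det≡1) ⟨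
  (g · x) · (adj g · g)   ≡⟨ ·-assoc (g · x) (adj g) g ⟨
  conj g x · g            ∎))
  where open ≡-Reasoning

-- The conjugates Ū^w V̄ Ū^(-w) of V̄

powU : ℤ → M₂
powU w = mat (+ 1) (+ 0) (w ℤ.* + 2) (+ 1)

conjV : ℤ → M₂
conjV w = (powU w · V) · powU (ℤ.- w)

Γ₀2-powU : ∀ w → Γ₀2 (powU w)
Γ₀2-powU w = mkΓ₀2 {powU w} (det-powU w) (divides w refl)
  where
  det-powU : ∀ w → + 1 ℤ.* + 1 ℤ.- + 0 ℤ.* (w ℤ.* + 2) ≡ + 1
  det-powU = solve-∀ ℤ-ring

powU-+ : ∀ u w → powU u · powU w ≡ powU (u ℤ.+ w)
powU-+ u w = mat-cong (entry-a w) refl (entry-c u w) (entry-d u)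
  where
  entry-a : ∀ w → + 1 ℤ.* + 1 ℤ.+ + 0 ℤ.* (w ℤ.* + 2) ≡ + 1
  entry-a = solve-∀ ℤ-ring
  entry-c : ∀ u w → u ℤ.* + 2 ℤ.* + 1 ℤ.+ + 1 ℤ.* (w ℤ.* + 2) ≡ (u ℤ.+ w) ℤ.* + 2
  entry-c = solve-∀ ℤ-ring
  entry-d : ∀ u → u ℤ.* + 2 ℤ.* + 0 ℤ.+ + 1 ℤ.* + 1 ≡ + 1
  entry-d = solve-∀ ℤ-ring

powU-inverseˡ : ∀ w → powU (ℤ.- w) · powU w ≡ I₂
powU-inverseˡ w = trans (powU-+ (ℤ.- w) w) (cong powU (ℤP.+-inverseˡ w))

Γ₀2-conjV : ∀ w → Γ₀2 (conjV w)
Γ₀2-conjV w = Γ₀2-· (powU w · V) (powU (ℤ.- w)) (Γ₀2-· (powU w) V (Γ₀2-powU w) Γ₀2-V) (Γ₀2-powU (ℤ.- w))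

powU-intertwines-V : ∀ w → Intertwines (powU w) V (conjV w)
powU-intertwines-V w = intertwines (≡⇒≅ (begin
  powU w · V                                ≡⟨ ·-identityʳ (powU w · V) ⟨
  (powU w · V) · I₂                         ≡⟨ cong ((powU w · V) ·_) (powU-inverseˡ w) ⟨
  (powU w · V) · (powU (ℤ.- w) · powU w)    ≡⟨ ·-assoc (powU w · V) (powU (ℤ.- w)) (powU w) ⟨
  conjV w · powU w                          ∎))
  where open ≡-Reasoning

powU-intertwines-conjV : ∀ w → Intertwines (powU (ℤ.- w)) (conjV w) V
powU-intertwines-conjV w = intertwines (≡⇒≅ (begin
  powU (ℤ.- w) · ((powU w · V) · powU (ℤ.- w))  ≡⟨ ·-assoc (powU (ℤ.- w)) (powU w · V) (powU (ℤ.- w)) ⟨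
  (powU (ℤ.- w) · (powU w · V)) · powU (ℤ.- w)  ≡⟨ cong (_· powU (ℤ.- w)) (·-assoc (powU (ℤ.- w)) (powU w) V) ⟨
  ((powU (ℤ.- w) · powU w) · V) · powU (ℤ.- w)  ≡⟨ cong (λ g → (g · V) · powU (ℤ.- w)) (powU-inverseˡ w) ⟩
  (I₂ · V) · powU (ℤ.- w)                       ≡⟨ cong (_· powU (ℤ.- w)) (·-identityˡ V) ⟩
  V · powU (ℤ.- w)                              ∎))
  where open ≡-Reasoning

conjV-shift : ∀ u w → Intertwines (powU u) (conjV w) (conjV (w ℤ.+ u))
conjV-shift u w = subst (λ g → Intertwines g (conjV w) (conjV (w ℤ.+ u)))
  (trans (powU-+ (w ℤ.+ u) (ℤ.- w)) (cong powU (cancel w u)))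
  (intertwines-· (powU-intertwines-conjV w) (powU-intertwines-V (w ℤ.+ u)))
  where
  cancel : ∀ w u → (w ℤ.+ u) ℤ.+ ℤ.- w ≡ u
  cancel = solve-∀ ℤ-ring

conjV-square : ∀ w → conjV w · conjV w ≅ I₂
conjV-square w = intertwines-I (proj₁ (Γ₀2-powU w))
  (intertwines (≅-trans (·-congˡ (powU w) (≅-sym (neg-≅ I₂))) (intertwining (intertwines-square (powU-intertwines-V w)))))

conjV≉I : ∀ w → ¬ (conjV w ≈ I₂)
conjV≉I w (inj₁ e) with cong b e
... | ()
conjV≉I w (inj₂ e) with cong b e
... | ()

module _ (ψ : Character) where
  open import Relation.Binary.Reasoning.Setoid ℚ/ℤ.setoid

  χ-cong : ∀ {x y} → Γ₀2 x → x ≅ y → χ ψ x ≋ χ ψ y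
  χ-cong {x} {y} Γx ⟪ x≈y ⟫ = ⟨ resp ψ x y Γx x≈y ⟩

  χ-· : ∀ x y → Γ₀2 x → Γ₀2 y → χ ψ (x · y) ≋ χ ψ x ℚ.+ χ ψ y
  χ-· x y Γx Γy = ⟨ hom ψ x y Γx Γy ⟩

  χ-I : χ ψ I₂ ≋ 0ℚ
  χ-I = ℚ/ℤ.identityʳ-unique (χ ψ I₂) (χ ψ I₂) (≋-sym (χ-· I₂ I₂ Γ₀2-I Γ₀2-I))

  χ-inverse : ∀ x y → Γ₀2 x → Γ₀2 y → x · y ≅ I₂ → χ ψ x ≋ ℚ.- χ ψ y
  χ-inverse x y Γx Γy xy≅I = ℚ/ℤ.inverseˡ-unique (χ ψ x) (χ ψ y) (begin
    χ ψ x ℚ.+ χ ψ y   ≈⟨ χ-· x y Γx Γy ⟨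
    χ ψ (x · y)       ≈⟨ χ-cong (Γ₀2-· x y Γx Γy) xy≅I ⟩
    χ ψ I₂            ≈⟨ χ-I ⟩
    0ℚ                ∎)

  χ-V+V : χ ψ V ℚ.+ χ ψ V ≋ 0ℚ
  χ-V+V = begin
    χ ψ V ℚ.+ χ ψ V   ≈⟨ χ-· V V Γ₀2-V Γ₀2-V ⟨
    χ ψ (neg I₂)      ≈⟨ χ-cong (Γ₀2-· V V Γ₀2-V Γ₀2-V) (neg-≅ I₂) ⟩
    χ ψ I₂            ≈⟨ χ-I ⟩
    0ℚ                ∎

  χ-powU-neg : ∀ w → χ ψ (powU (ℤ.- w)) ≋ ℚ.- χ ψ (powU w)
  χ-powU-neg w = χ-inverse (powU (ℤ.- w)) (powU w) (Γ₀2-powU (ℤ.- w)) (Γ₀2-powU w) (≡⇒≅ (powU-inverseˡ w))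

  χ-powU-ℕ : ∀ k → χ ψ (powU (+ k)) ≋ (+ k) ⊙ χ ψ U
  χ-powU-ℕ zero = ≋-trans χ-I (≡⇒≋ (sym (ℚP.*-zeroˡ (χ ψ U))))
  χ-powU-ℕ (suc k) = begin
    χ ψ (powU (+ suc k))                 ≡⟨ cong (χ ψ) (powU-+ (+ 1) (+ k)) ⟨
    χ ψ (U · powU (+ k))                 ≈⟨ χ-· U (powU (+ k)) Γ₀2-U (Γ₀2-powU (+ k)) ⟩
    χ ψ U ℚ.+ χ ψ (powU (+ k))           ≈⟨ +-cong (≡⇒≋ (sym (ℚP.*-identityˡ (χ ψ U)))) (χ-powU-ℕ k) ⟩
    (+ 1) ⊙ χ ψ U ℚ.+ (+ k) ⊙ χ ψ U      ≡⟨ ⊙-homo-+ (+ 1) (+ k) (χ ψ U) ⟨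
    (+ suc k) ⊙ χ ψ U                    ∎

  χ-powU : ∀ w → χ ψ (powU w) ≋ w ⊙ χ ψ U
  χ-powU (+ k) = χ-powU-ℕ k
  χ-powU -[1+ k ] = begin
    χ ψ (powU -[1+ k ])                  ≈⟨ χ-powU-neg (+ suc k) ⟩
    ℚ.- χ ψ (powU (+ suc k))             ≈⟨ neg-cong (χ-powU-ℕ (suc k)) ⟩
    ℚ.- ((+ suc k) ⊙ χ ψ U)              ≡⟨ ⊙-neg (+ suc k) (χ ψ U) ⟨
    -[1+ k ] ⊙ χ ψ U                     ∎

∣z∣≡1⇒z≡±1 : ∀ z → ℤ.∣ z ∣ ≡ 1 → z ≡ + 1 ⊎ z ≡ -[1+ 0 ]
∣z∣≡1⇒z≡±1 (+ 1) refl = inj₁ refl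
∣z∣≡1⇒z≡±1 -[1+ 0 ] refl = inj₂ refl

∣z∣≡2⇒z≡±2 : ∀ z → ℤ.∣ z ∣ ≡ 2 → z ≡ + 2 ⊎ z ≡ -[1+ 1 ]
∣z∣≡2⇒z≡±2 (+ 2) refl = inj₁ refl
∣z∣≡2⇒z≡±2 -[1+ 1 ] refl = inj₂ refl

±1-factors : ∀ p q → p ℤ.* q ≡ + 1 → (p ≡ + 1 × q ≡ + 1) ⊎ (p ≡ -[1+ 0 ] × q ≡ -[1+ 0 ])
±1-factors p q pq≡1 with ∣z∣≡1⇒z≡±1 p (ℕP.m*n≡1⇒m≡1 _ _ ∣pq∣≡1) | ∣z∣≡1⇒z≡±1 q (ℕP.m*n≡1⇒n≡1 ℤ.∣ p ∣ _ ∣pq∣≡1)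
  where
  ∣pq∣≡1 : ℤ.∣ p ∣ ℕ.* ℤ.∣ q ∣ ≡ 1
  ∣pq∣≡1 = trans (sym (ℤP.abs-* p q)) (cong ℤ.∣_∣ pq≡1)
... | inj₁ refl | inj₁ refl = inj₁ (refl , refl)
... | inj₂ refl | inj₂ refl = inj₂ (refl , refl)
±1-factors _ _ () | inj₁ refl | inj₂ refl
±1-factors _ _ () | inj₂ refl | inj₁ refl

module _ where
  private
    square-a : ∀ a b c d → a ℤ.* (a ℤ.+ d) ≡ (a ℤ.* a ℤ.+ b ℤ.* c) ℤ.+ (a ℤ.* d ℤ.- b ℤ.* c)
    square-a = solve-∀ ℤ-ring
    square-b : ∀ a b d → a ℤ.* b ℤ.+ b ℤ.* d ≡ b ℤ.* (a ℤ.+ d)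
    square-b = solve-∀ ℤ-ring
    square-c : ∀ a c d → c ℤ.* a ℤ.+ d ℤ.* c ≡ c ℤ.* (a ℤ.+ d)
    square-c = solve-∀ ℤ-ring

  -- By Cayley–Hamilton x² = t x - 1 with t = a + d, so x² = ±1 forces t x = 2 or t x = 0.
  involution-trace-zero : ∀ x → det x ≡ + 1 → ¬ (x ≈ I₂) → (x · x) ≈ I₂ → a x ℤ.+ d x ≡ + 0
  involution-trace-zero (mat a b c d) det≡1 x≉I (inj₁ x²≡I) = ⊥-elim (x≉I x≈I)
    where
    at≡2 : a ℤ.* (a ℤ.+ d) ≡ + 2
    at≡2 = trans (square-a a b c d) (cong₂ ℤ._+_ (cong M₂.a x²≡I) det≡1)
    t≢0 : a ℤ.+ d ≢ + 0
    t≢0 t≡0 with trans (sym (cong (a ℤ.*_) t≡0)) at≡2 | ℤP.*-zeroʳ a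
    ... | at≡2' | a0≡0 with trans (sym a0≡0) at≡2'
    ... | ()
    vanishes : ∀ z → z ℤ.* (a ℤ.+ d) ≡ + 0 → z ≡ + 0
    vanishes z zt≡0 with ℤP.i*j≡0⇒i≡0∨j≡0 z zt≡0
    ... | inj₁ z≡0 = z≡0
    ... | inj₂ t≡0 = ⊥-elim (t≢0 t≡0)
    b≡0 : b ≡ + 0
    b≡0 = vanishes b (trans (sym (square-b a b d)) (cong M₂.b x²≡I))
    c≡0 : c ≡ + 0
    c≡0 = vanishes c (trans (sym (square-c a c d)) (cong M₂.c x²≡I))
    x≈I : mat a b c d ≈ I₂
    x≈I with ±1-factors a d (trans (sym (ℤP.+-identityʳ (a ℤ.* d))) (subst (λ z → a ℤ.* d ℤ.- z ℤ.* c ≡ + 1) b≡0 det≡1))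
    ... | inj₁ (refl , refl) rewrite b≡0 | c≡0 = inj₁ refl
    ... | inj₂ (refl , refl) rewrite b≡0 | c≡0 = inj₂ refl
  involution-trace-zero (mat a b c d) det≡1 x≉I (inj₂ x²≡-I) with a ℤ.+ d ℤ.≟ + 0
  ... | yes t≡0 = t≡0
  ... | no t≢0 = ⊥-elim (1≢0 (trans (sym det≡1) det≡0))
    where
    vanishes : ∀ z → z ℤ.* (a ℤ.+ d) ≡ + 0 → z ≡ + 0
    vanishes z zt≡0 with ℤP.i*j≡0⇒i≡0∨j≡0 z zt≡0
    ... | inj₁ z≡0 = z≡0
    ... | inj₂ t≡0 = ⊥-elim (t≢0 t≡0)
    a≡0 : a ≡ + 0
    a≡0 = vanishes a (trans (square-a a b c d) (cong₂ ℤ._+_ (cong M₂.a x²≡-I) det≡1))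
    b≡0 : b ≡ + 0
    b≡0 = vanishes b (trans (sym (square-b a b d)) (cong M₂.b x²≡-I))
    det≡0 : a ℤ.* d ℤ.- b ℤ.* c ≡ + 0
    det≡0 rewrite a≡0 | b≡0 = refl
    1≢0 : + 1 ≢ + 0
    1≢0 ()

module _ where
  open import Relation.Binary.Reasoning.Setoid ≅-setoid

  intertwines-respˡ : ∀ {g x x' y} → x ≅ x' → Intertwines g x y → Intertwines g x' y
  intertwines-respˡ {g} x≅x' (intertwines gx≅yg) = intertwines (≅-trans (·-congˡ g (≅-sym x≅x')) gx≅yg)

  intertwines-inverse : ∀ {g x y} → det g ≡ + 1 → Intertwines g x y → Intertwines (adj g) y x
  intertwines-inverse {g} {x} {y} det≡1 (intertwines gx≅yg) = intertwines (begin
    adj g · y                         ≡⟨ ·-identityʳ (adj g · y) ⟨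
    (adj g · y) · I₂                  ≡⟨ cong ((adj g · y) ·_) (·-adjʳ g det≡1) ⟨
    (adj g · y) · (g · adj g)         ≡⟨ ·-assoc (adj g · y) g (adj g) ⟨
    ((adj g · y) · g) · adj g         ≡⟨ cong (_· adj g) (·-assoc (adj g) y g) ⟩
    (adj g · (y · g)) · adj g         ≈⟨ ·-congʳ (adj g) (·-congˡ (adj g) gx≅yg) ⟨
    (adj g · (g · x)) · adj g         ≡⟨ cong (_· adj g) (·-assoc (adj g) g x) ⟨
    ((adj g · g) · x) · adj g         ≡⟨ cong (λ h → (h · x) · adj g) (·-adjˡ g det≡1) ⟩
    (I₂ · x) · adj g                  ≡⟨ cong (_· adj g) (·-identityˡ x) ⟩
    x · adj g                         ∎)

Involution-conj : ∀ g x → Γ₀2 g → Involution Γ₀2 x → Involution Γ₀2 (conj g x)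
Involution-conj g x Γg@(det-g , _) (Γx , x≉I , x²≈I) =
  Γ₀2-· (g · x) (adj g) (Γ₀2-· g x Γg Γx) (Γ₀2-adj g Γg) ,
  (λ y≈I → x≉I (unwrap (intertwines-I (trans (det-adj g) det-g)
                  (intertwines-respˡ ⟪ y≈I ⟫ (intertwines-inverse det-g g-conj))))) ,
  unwrap (intertwines-I det-g (intertwines-respˡ ⟪ x²≈I ⟫ (intertwines-square g-conj)))
  where
  g-conj : Intertwines g x (conj g x)
  g-conj = intertwines-conj g x det-g

-- Reduction of an involution of Γ̄₀(2) to V̄

involution-d≡-a : ∀ x → Involution Γ₀2 x → d x ≡ ℤ.- a x
involution-d≡-a x ((det≡1 , _) , x≉I , x²≈I) =
  trans (isolate (a x) (d x)) (trans (cong (ℤ._- a x) (involution-trace-zero x det≡1 x≉I x²≈I)) (ℤP.+-identityˡ (ℤ.- a x)))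
  where
  isolate : ∀ a d → d ≡ (a ℤ.+ d) ℤ.- a
  isolate = solve-∀ ℤ-ring

∣m⊖n∣<m : ∀ m n → 0 ℕ.< n → n ℕ.< 2 ℕ.* m → ℤ.∣ m ℤ.⊖ n ∣ ℕ.< m
∣m⊖n∣<m m n 0<n n<2m with n ℕ.≤? m
∣m⊖n∣<m (suc m) (suc n) 0<n n<2m | yes n≤m rewrite ℤP.⊖-≥ n≤m = s≤s (ℕP.m∸n≤m m n)
∣m⊖n∣<m m n 0<n n<2m | no n≰m rewrite ℤP.∣⊖∣-< (ℕP.≰⇒> n≰m) =
  ℕP.+-cancelʳ-< m (n ℕ.∸ m) m
    (subst₂ ℕ._<_ (sym (ℕP.m∸n+n≡m (ℕP.<⇒≤ (ℕP.≰⇒> n≰m)))) (cong (m ℕ.+_) (ℕP.+-identityʳ m)) n<2m)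

shorten : ∀ x z → z ≢ + 0 → ℤ.∣ z ∣ ℕ.< 2 ℕ.* ℤ.∣ x ∣ →
          ℤ.∣ x ℤ.+ z ∣ ℕ.< ℤ.∣ x ∣ ⊎ ℤ.∣ x ℤ.- z ∣ ℕ.< ℤ.∣ x ∣
shorten (+ zero) z z≢0 ()
shorten x (+ zero) z≢0 _ = ⊥-elim (z≢0 refl)
shorten (+ suc m) (+ suc n) _ n<2m = inj₂ (∣m⊖n∣<m (suc m) (suc n) (s≤s z≤n) n<2m)
shorten (+ suc m) -[1+ n ] _ n<2m = inj₁ (∣m⊖n∣<m (suc m) (suc n) (s≤s z≤n) n<2m)
shorten -[1+ m ] (+ suc n) _ n<2m =
  inj₁ (subst (ℕ._< suc m) (ℤP.∣m⊖n∣≡∣n⊖m∣ (suc m) (suc n)) (∣m⊖n∣<m (suc m) (suc n) (s≤s z≤n) n<2m))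
shorten -[1+ m ] -[1+ n ] _ n<2m =
  inj₂ (subst (ℕ._< suc m) (ℤP.∣m⊖n∣≡∣n⊖m∣ (suc m) (suc n)) (∣m⊖n∣<m (suc m) (suc n) (s≤s z≤n) n<2m))

data Generator : M₂ → Set where
  T⁺ : Generator T
  T⁻ : Generator (adj T)
  U⁺ : Generator U
  U⁻ : Generator (adj U)

Γ₀2-generator : ∀ {g} → Generator g → Γ₀2 g
Γ₀2-generator T⁺ = Γ₀2-T
Γ₀2-generator T⁻ = Γ₀2-adj T Γ₀2-T
Γ₀2-generator U⁺ = Γ₀2-U
Γ₀2-generator U⁻ = Γ₀2-adj U Γ₀2-U

module _ where
  private
    entry-T : ∀ a b c d → (+ 1 ℤ.* a ℤ.+ + 1 ℤ.* c) ℤ.* + 1 ℤ.+ (+ 1 ℤ.* b ℤ.+ + 1 ℤ.* d) ℤ.* + 0 ≡ a ℤ.+ c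
    entry-T = solve-∀ ℤ-ring
    entry-T⁻ : ∀ a b c d → (+ 1 ℤ.* a ℤ.+ -[1+ 0 ] ℤ.* c) ℤ.* + 1 ℤ.+ (+ 1 ℤ.* b ℤ.+ -[1+ 0 ] ℤ.* d) ℤ.* + 0 ≡ a ℤ.- c
    entry-T⁻ = solve-∀ ℤ-ring
    entry-U : ∀ a b c d → (+ 1 ℤ.* a ℤ.+ + 0 ℤ.* c) ℤ.* + 1 ℤ.+ (+ 1 ℤ.* b ℤ.+ + 0 ℤ.* d) ℤ.* -[1+ 1 ] ≡ a ℤ.- + 2 ℤ.* b
    entry-U = solve-∀ ℤ-ring
    entry-U⁻ : ∀ a b c d → (+ 1 ℤ.* a ℤ.+ + 0 ℤ.* c) ℤ.* + 1 ℤ.+ (+ 1 ℤ.* b ℤ.+ + 0 ℤ.* d) ℤ.* + 2 ≡ a ℤ.+ + 2 ℤ.* b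
    entry-U⁻ = solve-∀ ℤ-ring

  a-conj-T : ∀ x → a (conj T x) ≡ a x ℤ.+ c x
  a-conj-T (mat a b c d) = entry-T a b c d

  a-conj-T⁻ : ∀ x → a (conj (adj T) x) ≡ a x ℤ.- c x
  a-conj-T⁻ (mat a b c d) = entry-T⁻ a b c d

  a-conj-U : ∀ x → a (conj U x) ≡ a x ℤ.- + 2 ℤ.* b x
  a-conj-U (mat a b c d) = entry-U a b c d

  a-conj-U⁻ : ∀ x → a (conj (adj U) x) ≡ a x ℤ.+ + 2 ℤ.* b x
  a-conj-U⁻ (mat a b c d) = entry-U⁻ a b c d

z*z≡∣z∣² : ∀ z → z ℤ.* z ≡ + (ℤ.∣ z ∣ ℕ.* ℤ.∣ z ∣)
z*z≡∣z∣² (+ n) = ℤP.+◃n≡+n (n ℕ.* n)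
z*z≡∣z∣² -[1+ n ] = ℤP.+◃n≡+n (suc n ℕ.* suc n)

∣b∣∣c∣≡1+∣a∣² : ∀ a b c → a ℤ.* ℤ.- a ℤ.- b ℤ.* c ≡ + 1 → ℤ.∣ b ∣ ℕ.* ℤ.∣ c ∣ ≡ suc (ℤ.∣ a ∣ ℕ.* ℤ.∣ a ∣)
∣b∣∣c∣≡1+∣a∣² a b c det≡1 = begin
  ℤ.∣ b ∣ ℕ.* ℤ.∣ c ∣                          ≡⟨ ℤP.abs-* b c ⟨
  ℤ.∣ b ℤ.* c ∣                                ≡⟨ cong ℤ.∣_∣ (trans (isolate a b c) (cong (λ z → a ℤ.* ℤ.- a ℤ.- z) det≡1)) ⟩
  ℤ.∣ a ℤ.* ℤ.- a ℤ.- + 1 ∣                     ≡⟨ cong ℤ.∣_∣ (rearrange a) ⟩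
  ℤ.∣ ℤ.- (+ 1 ℤ.+ a ℤ.* a) ∣                   ≡⟨ ℤP.∣-i∣≡∣i∣ (+ 1 ℤ.+ a ℤ.* a) ⟩
  ℤ.∣ + 1 ℤ.+ a ℤ.* a ∣                         ≡⟨ cong (λ z → ℤ.∣ + 1 ℤ.+ z ∣) (z*z≡∣z∣² a) ⟩
  suc (ℤ.∣ a ∣ ℕ.* ℤ.∣ a ∣)                     ∎
  where
  open ≡-Reasoning
  isolate : ∀ a b c → b ℤ.* c ≡ a ℤ.* ℤ.- a ℤ.- (a ℤ.* ℤ.- a ℤ.- b ℤ.* c)
  isolate = solve-∀ ℤ-ring
  rearrange : ∀ a → a ℤ.* ℤ.- a ℤ.- + 1 ≡ ℤ.- (+ 1 ℤ.+ a ℤ.* a)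
  rearrange = solve-∀ ℤ-ring

trace-zero-b≢0∧c≢0 : ∀ a b c → a ℤ.* ℤ.- a ℤ.- b ℤ.* c ≡ + 1 → b ≢ + 0 × c ≢ + 0
trace-zero-b≢0∧c≢0 a b c det≡1 = b≢0 , c≢0
  where
  b≢0 : b ≢ + 0
  b≢0 refl with ∣b∣∣c∣≡1+∣a∣² a (+ 0) c det≡1
  ... | ()
  c≢0 : c ≢ + 0
  c≢0 refl with trans (sym (ℕP.*-zeroʳ ℤ.∣ b ∣)) (∣b∣∣c∣≡1+∣a∣² a b (+ 0) det≡1)
  ... | ()

extremal-solution : ∀ A B C → B ℕ.* C ≡ suc (A ℕ.* A) → 2 ℕ.* A ℕ.≤ C → A ℕ.≤ B → C ≢ 1 →
                    A ≡ 1 × B ≡ 1 × C ≡ 2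
extremal-solution zero B C BC≡1 _ _ C≢1 = ⊥-elim (C≢1 (ℕP.m*n≡1⇒n≡1 B C BC≡1))
extremal-solution 1 zero C () _ _ _
extremal-solution 1 1 C C+0≡2 _ _ _ = refl , refl , trans (sym (ℕP.+-identityʳ C)) C+0≡2
extremal-solution 1 (suc (suc B)) 1 _ (s≤s ()) _ _
extremal-solution 1 (suc (suc B)) (suc (suc C)) e _ _ _ with ℕP.m+n≡0⇒n≡0 C (ℕP.suc-injective (ℕP.suc-injective e))
... | ()
extremal-solution (suc (suc A)) B C BC≡1+A² 2A≤C A≤B _ with ℕP.+-cancelˡ-≤ (A' ℕ.* A') (A' ℕ.* A') 1 A²+A²≤A²+1
  where
  A' : ℕ
  A' = suc (suc A)
  A²+A²≤A²+1 : A' ℕ.* A' ℕ.+ A' ℕ.* A' ℕ.≤ A' ℕ.* A' ℕ.+ 1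
  A²+A²≤A²+1 = subst₂ ℕ._≤_ (double A') (trans BC≡1+A² (ℕP.+-comm 1 (A' ℕ.* A'))) (ℕP.*-mono-≤ A≤B 2A≤C)
    where
    double : ∀ n → n ℕ.* (2 ℕ.* n) ≡ n ℕ.* n ℕ.+ n ℕ.* n
    double = Data.Nat.Tactic.RingSolver.solve-∀
... | s≤s ()

Even⇒∣z∣≢1 : ∀ {z} → Even z → ℤ.∣ z ∣ ≢ 1
Even⇒∣z∣≢1 {z} 2∣z ∣z∣≡1 with ∣z∣≡1⇒z≡±1 z ∣z∣≡1
... | inj₁ refl = ¬Even1 2∣z
... | inj₂ refl = ¬Even1 (ℤ∣.∣m⇒∣-m 2∣z)

unshortenable : ∀ a b c → a ℤ.* ℤ.- a ℤ.- b ℤ.* c ≡ + 1 → Even c →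
                2 ℕ.* ℤ.∣ a ∣ ℕ.≤ ℤ.∣ c ∣ → ℤ.∣ a ∣ ℕ.≤ ℤ.∣ b ∣ →
                mat a b c (ℤ.- a) ≅ V ⊎ conj T (mat a b c (ℤ.- a)) ≅ V
unshortenable a b c det≡1 2∣c 2a≤c a≤b
  with extremal-solution ℤ.∣ a ∣ ℤ.∣ b ∣ ℤ.∣ c ∣ (∣b∣∣c∣≡1+∣a∣² a b c det≡1) 2a≤c a≤b (Even⇒∣z∣≢1 2∣c)
... | ∣a∣≡1 , ∣b∣≡1 , ∣c∣≡2 with ∣z∣≡1⇒z≡±1 a ∣a∣≡1 | ∣z∣≡1⇒z≡±1 b ∣b∣≡1 | ∣z∣≡2⇒z≡±2 c ∣c∣≡2
unshortenable _ _ _ () _ _ _ | _ | inj₁ refl | inj₁ refl | inj₁ refl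
unshortenable _ _ _ _  _ _ _ | _ | inj₁ refl | inj₁ refl | inj₂ refl = inj₂ ≅-refl
unshortenable _ _ _ _  _ _ _ | _ | inj₁ refl | inj₂ refl | inj₁ refl = inj₁ (neg-≅ V)
unshortenable _ _ _ () _ _ _ | _ | inj₁ refl | inj₂ refl | inj₂ refl
unshortenable _ _ _ () _ _ _ | _ | inj₂ refl | inj₁ refl | inj₁ refl
unshortenable _ _ _ _  _ _ _ | _ | inj₂ refl | inj₁ refl | inj₂ refl = inj₁ ≅-refl
unshortenable _ _ _ _  _ _ _ | _ | inj₂ refl | inj₂ refl | inj₁ refl = inj₂ (neg-≅ V)
unshortenable _ _ _ () _ _ _ | _ | inj₂ refl | inj₂ refl | inj₂ refl

-- Euclid's algorithm on ∣a∣: conjugation by T̄^±1 turns a into a ± c, by Ū^∓1 into a ± 2b, and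
-- when neither shortens a the involution is ±V̄ or ±T̄⁻¹V̄T̄.
module _ (P : M₂ → Set)
         (P-resp : ∀ {x y} → x ≅ y → P y → P x)
         (P-conj : ∀ {g x} → Generator g → P (conj g x) → P x)
         (P-V : P V) where

  private
    descend : ∀ {g} x → Generator g → ℤ.∣ a (conj g x) ∣ ℕ.< ℤ.∣ a x ∣ →
              WfRec ℕ._<_ (Acc ℕ._<_) ℤ.∣ a x ∣ → Involution Γ₀2 x → P x
    reduce : ∀ x → Acc ℕ._<_ ℤ.∣ a x ∣ → Involution Γ₀2 x → P x

    descend {g} x gen shorter rec inv =
      P-conj gen (reduce (conj g x) (rec shorter) (Involution-conj g x (Γ₀2-generator gen) inv))

    reduce x@(mat a b c d) (acc rec) inv@(Γx , _) = by-size
      where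
      d≡-a : d ≡ ℤ.- a
      d≡-a = involution-d≡-a x inv
      det≡1 : a ℤ.* ℤ.- a ℤ.- b ℤ.* c ≡ + 1
      det≡1 = subst (λ z → a ℤ.* z ℤ.- b ℤ.* c ≡ + 1) d≡-a (proj₁ Γx)
      c≢0 : c ≢ + 0
      c≢0 = proj₂ (trace-zero-b≢0∧c≢0 a b c det≡1)
      2b≢0 : + 2 ℤ.* b ≢ + 0
      2b≢0 2b≡0 with ℤP.i*j≡0⇒i≡0∨j≡0 (+ 2) 2b≡0
      ... | inj₂ b≡0 = proj₁ (trace-zero-b≢0∧c≢0 a b c det≡1) b≡0
      by-size : P x
      by-size with ℤ.∣ c ∣ ℕ.<? 2 ℕ.* ℤ.∣ a ∣
      ... | yes c<2a with shorten a c c≢0 c<2a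
      ...   | inj₁ shorter = descend x T⁺ (subst (ℕ._< ℤ.∣ a ∣) (cong ℤ.∣_∣ (sym (a-conj-T x))) shorter) rec inv
      ...   | inj₂ shorter = descend x T⁻ (subst (ℕ._< ℤ.∣ a ∣) (cong ℤ.∣_∣ (sym (a-conj-T⁻ x))) shorter) rec inv
      by-size | no c≮2a with ℤ.∣ b ∣ ℕ.<? ℤ.∣ a ∣
      ... | yes b<a with shorten a (+ 2 ℤ.* b) 2b≢0 (subst (ℕ._< 2 ℕ.* ℤ.∣ a ∣) (sym (ℤP.abs-* (+ 2) b)) (ℕP.*-monoʳ-< 2 b<a))
      ...   | inj₁ shorter = descend x U⁻ (subst (ℕ._< ℤ.∣ a ∣) (cong ℤ.∣_∣ (sym (a-conj-U⁻ x))) shorter) rec inv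
      ...   | inj₂ shorter = descend x U⁺ (subst (ℕ._< ℤ.∣ a ∣) (cong ℤ.∣_∣ (sym (a-conj-U x))) shorter) rec inv
      by-size | no c≮2a | no b≮a rewrite d≡-a
        with unshortenable a b c det≡1 (Γ₀2⇒Even-c {x} Γx) (ℕP.≮⇒≥ c≮2a) (ℕP.≮⇒≥ b≮a)
      ... | inj₁ x≅V = P-resp x≅V P-V
      ... | inj₂ Tx≅V = P-conj T⁺ (P-resp Tx≅V P-V)

  involution-induction : ∀ x → Involution Γ₀2 x → P x
  involution-induction x = reduce x (Data.Nat.Induction.<-wellFounded ℤ.∣ a x ∣)

-- The centraliser of V̄ in PSL₂(ℤ)

squares≡1 : ∀ x y → x ℤ.* x ℤ.+ y ℤ.* y ≡ + 1 →
            (x ≡ + 0 × (y ≡ + 1 ⊎ y ≡ -[1+ 0 ])) ⊎ ((x ≡ + 1 ⊎ x ≡ -[1+ 0 ]) × y ≡ + 0)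
squares≡1 x y sum≡1 with ℤ.∣ x ∣ | ℤ.∣ y ∣ | ∣z∣≡1⇒z≡±1 x | ∣z∣≡1⇒z≡±1 y | ℤP.∣i∣≡0⇒i≡0 {x} | ℤP.∣i∣≡0⇒i≡0 {y}
  | ℤP.+-injective (trans (sym (cong₂ ℤ._+_ (z*z≡∣z∣² x) (z*z≡∣z∣² y))) sum≡1)
... | zero | Y | _ | y≡±1 | x≡0 | _ | Y²≡1 = inj₁ (x≡0 refl , y≡±1 (ℕP.m*n≡1⇒m≡1 Y Y Y²≡1))
... | 1 | zero | x≡±1 | _ | _ | y≡0 | _ = inj₂ (x≡±1 refl , y≡0 refl)
... | 1 | suc _ | _ | _ | _ | _ | ()
... | suc (suc _) | _ | _ | _ | _ | _ | ()

squares≢-1 : ∀ x y → x ℤ.* x ℤ.+ y ℤ.* y ≢ -[1+ 0 ]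
squares≢-1 x y sum≡-1 with trans (sym (cong₂ ℤ._+_ (z*z≡∣z∣² x) (z*z≡∣z∣² y))) sum≡-1
... | ()

module _ where
  private
    commuting-form : ∀ p q s t X Y → p ℤ.+ q ≡ X → q ≡ Y → s ≡ ℤ.- (+ 2 ℤ.* q) → t ≡ p ℤ.+ + 2 ℤ.* q →
                     mat p q s t ≡ mat (X ℤ.- Y) Y (ℤ.- (+ 2 ℤ.* Y)) ((X ℤ.- Y) ℤ.+ + 2 ℤ.* Y)
    commuting-form p q s t X Y refl refl refl refl = mat-cong (isolate p q) refl refl (cong (ℤ._+ + 2 ℤ.* q) (isolate p q))
      where
      isolate : ∀ p q → p ≡ (p ℤ.+ q) ℤ.- q
      isolate = solve-∀ ℤ-ring

    -- each equation of M V = ±V M, with its right-hand side moved to the left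
    move : ∀ {l r} → l ≡ r → l ℤ.- r ≡ + 0
    move {l} refl = ℤP.+-inverseʳ l

    s-eq : ∀ p q s → p ℤ.* -[1+ 0 ] ℤ.+ q ℤ.* -[1+ 1 ] ℤ.- (-[1+ 0 ] ℤ.* p ℤ.+ + 1 ℤ.* s) ≡ ℤ.- (+ 2 ℤ.* q) ℤ.- s
    s-eq = solve-∀ ℤ-ring
    t-eq : ∀ p q t → p ℤ.* + 1 ℤ.+ q ℤ.* + 1 ℤ.- (-[1+ 0 ] ℤ.* q ℤ.+ + 1 ℤ.* t) ≡ (p ℤ.+ + 2 ℤ.* q) ℤ.- t
    t-eq = solve-∀ ℤ-ring
    det-eq : ∀ p q → p ℤ.* (p ℤ.+ + 2 ℤ.* q) ℤ.- q ℤ.* ℤ.- (+ 2 ℤ.* q) ≡ (p ℤ.+ q) ℤ.* (p ℤ.+ q) ℤ.+ q ℤ.* q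
    det-eq = solve-∀ ℤ-ring
    s-eq⁻ : ∀ p q s → p ℤ.* -[1+ 0 ] ℤ.+ q ℤ.* -[1+ 1 ] ℤ.- ℤ.- (-[1+ 0 ] ℤ.* p ℤ.+ + 1 ℤ.* s) ≡ s ℤ.- (+ 2 ℤ.* p ℤ.+ + 2 ℤ.* q)
    s-eq⁻ = solve-∀ ℤ-ring
    t-eq⁻ : ∀ p q t → p ℤ.* + 1 ℤ.+ q ℤ.* + 1 ℤ.- ℤ.- (-[1+ 0 ] ℤ.* q ℤ.+ + 1 ℤ.* t) ≡ t ℤ.- ℤ.- p
    t-eq⁻ = solve-∀ ℤ-ring
    det-eq⁻ : ∀ p q → p ℤ.* ℤ.- p ℤ.- q ℤ.* (+ 2 ℤ.* p ℤ.+ + 2 ℤ.* q) ≡ ℤ.- ((p ℤ.+ q) ℤ.* (p ℤ.+ q) ℤ.+ q ℤ.* q)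
    det-eq⁻ = solve-∀ ℤ-ring

    solve-for : ∀ x y → x ℤ.- y ≡ + 0 → x ≡ y
    solve-for x y = ℤP.i-j≡0⇒i≡j x y

  -- Commuting with V̄ forces M = X + Y V with X² + Y² = 1.
  V-centralizer : ∀ M → det M ≡ + 1 → M · V ≅ V · M → M ≅ I₂ ⊎ M ≅ V
  V-centralizer (mat p q s t) det≡1 ⟪ inj₁ MV≡VM ⟫ = by-cases (squares≡1 (p ℤ.+ q) q (trans (sym (det-eq p q)) det≡1'))
    where
    s≡ : s ≡ ℤ.- (+ 2 ℤ.* q)
    s≡ = sym (solve-for _ s (trans (sym (s-eq p q s)) (move (cong M₂.a MV≡VM))))
    t≡ : t ≡ p ℤ.+ + 2 ℤ.* q
    t≡ = sym (solve-for _ t (trans (sym (t-eq p q t)) (move (cong M₂.b MV≡VM))))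
    det≡1' : p ℤ.* (p ℤ.+ + 2 ℤ.* q) ℤ.- q ℤ.* ℤ.- (+ 2 ℤ.* q) ≡ + 1
    det≡1' = subst₂ (λ s t → p ℤ.* t ℤ.- q ℤ.* s ≡ + 1) s≡ t≡ det≡1
    form : ∀ X Y → p ℤ.+ q ≡ X → q ≡ Y → mat p q s t ≡ mat (X ℤ.- Y) Y (ℤ.- (+ 2 ℤ.* Y)) ((X ℤ.- Y) ℤ.+ + 2 ℤ.* Y)
    form X Y X≡ Y≡ = commuting-form p q s t X Y X≡ Y≡ s≡ t≡
    by-cases : (p ℤ.+ q ≡ + 0 × (q ≡ + 1 ⊎ q ≡ -[1+ 0 ])) ⊎ ((p ℤ.+ q ≡ + 1 ⊎ p ℤ.+ q ≡ -[1+ 0 ]) × q ≡ + 0) →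
               mat p q s t ≅ I₂ ⊎ mat p q s t ≅ V
    by-cases (inj₁ (X≡0 , inj₁ Y≡1)) = inj₂ (≡⇒≅ (form (+ 0) (+ 1) X≡0 Y≡1))
    by-cases (inj₁ (X≡0 , inj₂ Y≡-1)) = inj₂ (≅-trans (≡⇒≅ (form (+ 0) -[1+ 0 ] X≡0 Y≡-1)) (neg-≅ V))
    by-cases (inj₂ (inj₁ X≡1 , Y≡0)) = inj₁ (≡⇒≅ (form (+ 1) (+ 0) X≡1 Y≡0))
    by-cases (inj₂ (inj₂ X≡-1 , Y≡0)) = inj₁ (≅-trans (≡⇒≅ (form -[1+ 0 ] (+ 0) X≡-1 Y≡0)) (neg-≅ I₂))
  V-centralizer (mat p q s t) det≡1 ⟪ inj₂ MV≡-VM ⟫ = ⊥-elim (squares≢-1 (p ℤ.+ q) q sum≡-1)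
    where
    s≡ : s ≡ + 2 ℤ.* p ℤ.+ + 2 ℤ.* q
    s≡ = solve-for s _ (trans (sym (s-eq⁻ p q s)) (move (cong M₂.a MV≡-VM)))
    t≡ : t ≡ ℤ.- p
    t≡ = solve-for t _ (trans (sym (t-eq⁻ p q t)) (move (cong M₂.b MV≡-VM)))
    sum≡-1 : (p ℤ.+ q) ℤ.* (p ℤ.+ q) ℤ.+ q ℤ.* q ≡ -[1+ 0 ]
    sum≡-1 = trans (sym (ℤP.neg-involutive _)) (cong ℤ.-_ (trans (sym (det-eq⁻ p q))
               (subst₂ (λ s t → p ℤ.* t ℤ.- q ℤ.* s ≡ + 1) s≡ t≡ det≡1)))

-- Involutions of the kernel of a character

module _ (ψ : Character) where
  open import Relation.Binary.Reasoning.Setoid ℚ/ℤ.setoid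

  Ker⇒χ≋0 : ∀ x → Ker ψ x → χ ψ x ≋ 0ℚ
  Ker⇒χ≋0 x (_ , χx~0) = ⟨ χx~0 ⟩

  Ker-· : ∀ x y → Ker ψ x → Ker ψ y → Ker ψ (x · y)
  Ker-· x y Kx@(Γx , _) Ky@(Γy , _) = Γ₀2-· x y Γx Γy , unwrap (begin
    χ ψ (x · y)           ≈⟨ χ-· ψ x y Γx Γy ⟩
    χ ψ x ℚ.+ χ ψ y       ≈⟨ +-cong (Ker⇒χ≋0 x Kx) (Ker⇒χ≋0 y Ky) ⟩
    0ℚ ℚ.+ 0ℚ             ≡⟨ ℚP.+-identityʳ 0ℚ ⟩
    0ℚ                    ∎)

  Conj⇒Intertwines : ∀ {x y} → ((k , _) : Conj (Ker ψ) x y) → Intertwines k x y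
  Conj⇒Intertwines (_ , _ , kx≈yk) = intertwines ⟪ kx≈yk ⟫

  Conj-trans : ∀ {x y z} → Conj (Ker ψ) x y → Conj (Ker ψ) y z → Conj (Ker ψ) x z
  Conj-trans {x} {y} {z} x~y@(k , Kk , _) y~z@(l , Kl , _) =
    l · k , Ker-· l k Kl Kk ,
    unwrap (intertwining (intertwines-· (Conj⇒Intertwines {x} {y} x~y) (Conj⇒Intertwines {y} {z} y~z)))

  Ker-intro : ∀ x → Γ₀2 x → χ ψ x ≋ 0ℚ → Ker ψ x
  Ker-intro x Γx χx≋0 = Γx , unwrap χx≋0

  Ker-resp : ∀ {x y} → Ker ψ x → x ≅ y → Ker ψ y
  Ker-resp {x} Kx@(Γx , _) x≅y = Γ₀2-resp-≅ Γx x≅y , unwrap (≋-trans (≋-sym (χ-cong ψ Γx x≅y)) (Ker⇒χ≋0 x Kx))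

  conjV-periodic : ∀ m → IsInt ((+ m) ⊙ χ ψ U) → ∀ w q → Conj (Ker ψ) (conjV w) (conjV (w ℤ.+ q ℤ.* + m))
  conjV-periodic m m-int w q =
    powU (q ℤ.* + m) ,
    Ker-intro (powU (q ℤ.* + m)) (Γ₀2-powU (q ℤ.* + m)) (begin
      χ ψ (powU (q ℤ.* + m))        ≈⟨ χ-powU ψ (q ℤ.* + m) ⟩
      (q ℤ.* + m) ⊙ χ ψ U           ≡⟨ ⊙-assoc q (+ m) (χ ψ U) ⟩
      q ⊙ (+ m) ⊙ χ ψ U             ≈⟨ IsInt⇒≋0 (IsInt-⊙ q _ m-int) ⟩
      0ℚ                            ∎) ,
    unwrap (intertwining (conjV-shift (q ℤ.* + m) w))

  conjV-mod : ∀ m .{{_ : ℕ.NonZero m}} → IsInt ((+ m) ⊙ χ ψ U) → ∀ w → Conj (Ker ψ) (conjV w) (conjV (+ (w ℤDM.%ℕ m)))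
  conjV-mod m m-int w = subst (λ v → Conj (Ker ψ) (conjV w) (conjV v)) reduced (conjV-periodic m m-int w (ℤ.- q))
    where
    q : ℤ
    q = w ℤDM./ℕ m
    reduced : w ℤ.+ ℤ.- q ℤ.* + m ≡ + (w ℤDM.%ℕ m)
    reduced = trans (cong (λ v → v ℤ.+ ℤ.- q ℤ.* + m) (ℤDM.a≡a%ℕn+[a/ℕn]*n w m)) (cancel (+ (w ℤDM.%ℕ m)) q (+ m))
      where
      cancel : ∀ r q m → (r ℤ.+ q ℤ.* m) ℤ.+ ℤ.- q ℤ.* m ≡ r
      cancel = solve-∀ ℤ-ring

  module _ (χV≋0 : χ ψ V ≋ 0ℚ) where

    Ker-conjV : ∀ w → Ker ψ (conjV w)
    Ker-conjV w = Ker-intro (conjV w) (Γ₀2-conjV w) (begin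
      χ ψ ((powU w · V) · powU (ℤ.- w))                       ≈⟨ χ-· ψ (powU w · V) (powU (ℤ.- w)) ΓUʷV (Γ₀2-powU (ℤ.- w)) ⟩
      χ ψ (powU w · V) ℚ.+ χ ψ (powU (ℤ.- w))                ≈⟨ +-cong (χ-· ψ (powU w) V (Γ₀2-powU w) Γ₀2-V) (χ-powU-neg ψ w) ⟩
      (χ ψ (powU w) ℚ.+ χ ψ V) ℚ.+ ℚ.- χ ψ (powU w)          ≈⟨ +-congʳ (ℚ.- χ ψ (powU w)) (+-congˡ (χ ψ (powU w)) χV≋0) ⟩
      (χ ψ (powU w) ℚ.+ 0ℚ) ℚ.+ ℚ.- χ ψ (powU w)             ≡⟨ cancel (χ ψ (powU w)) ⟩
      0ℚ                                                      ∎)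
      where
      ΓUʷV : Γ₀2 (powU w · V)
      ΓUʷV = Γ₀2-· (powU w) V (Γ₀2-powU w) Γ₀2-V
      cancel : ∀ y → (y ℚ.+ 0ℚ) ℚ.+ ℚ.- y ≡ 0ℚ
      cancel = solve-∀ ℚ-ring

    conjV-Involution : ∀ w → Involution (Ker ψ) (conjV w)
    conjV-Involution w = Ker-conjV w , conjV≉I w , unwrap (conjV-square w)

    generator-value : ∀ {g} → Generator g → ∃ λ e → χ ψ g ≋ χ ψ (powU e)
    generator-value T⁺ = + 1 , (begin
      χ ψ (V · U)            ≈⟨ χ-· ψ V U Γ₀2-V Γ₀2-U ⟩
      χ ψ V ℚ.+ χ ψ U        ≈⟨ +-congʳ (χ ψ U) χV≋0 ⟩
      0ℚ ℚ.+ χ ψ U           ≡⟨ ℚP.+-identityˡ (χ ψ U) ⟩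
      χ ψ U                  ∎)
    generator-value T⁻ = -[1+ 0 ] , (begin
      χ ψ (adj T)            ≈⟨ χ-inverse ψ (adj T) T (Γ₀2-generator T⁻) Γ₀2-T ≅-refl ⟩
      ℚ.- χ ψ T              ≈⟨ neg-cong (proj₂ (generator-value T⁺)) ⟩
      ℚ.- χ ψ U              ≈⟨ χ-powU-neg ψ (+ 1) ⟨
      χ ψ (powU -[1+ 0 ])    ∎)
    generator-value U⁺ = + 1 , ≡⇒≋ refl
    generator-value U⁻ = -[1+ 0 ] , ≡⇒≋ refl

    Conj-conjV : ∀ x → Involution Γ₀2 x → ∃ λ w → Conj (Ker ψ) x (conjV w)
    Conj-conjV = involution-induction (λ x → ∃ λ w → Conj (Ker ψ) x (conjV w)) respects step base
      where
      respects : ∀ {x y} → x ≅ y → ∃ (λ w → Conj (Ker ψ) y (conjV w)) → ∃ λ w → Conj (Ker ψ) x (conjV w)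
      respects {x} {y} x≅y (w , k , Kk , ky≈wk) = w , k , Kk , unwrap (≅-trans (·-congˡ k x≅y) ⟪ ky≈wk ⟫)
      step : ∀ {g x} → Generator g → ∃ (λ w → Conj (Ker ψ) (conj g x) (conjV w)) → ∃ λ w → Conj (Ker ψ) x (conjV w)
      step {g} {x} gen (w , gx~w@(k , Kk@(Γk , _) , _)) with generator-value gen
      ... | e , χg≋χUᵉ =
        w ℤ.+ ℤ.- e , powU (ℤ.- e) · (k · g) , Ker-intro (powU (ℤ.- e) · (k · g)) Γ-new χ-new , unwrap (intertwining new)
        where
        Γg : Γ₀2 g
        Γg = Γ₀2-generator gen
        Γ-new : Γ₀2 (powU (ℤ.- e) · (k · g))
        Γ-new = Γ₀2-· (powU (ℤ.- e)) (k · g) (Γ₀2-powU (ℤ.- e)) (Γ₀2-· k g Γk Γg)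
        χ-new : χ ψ (powU (ℤ.- e) · (k · g)) ≋ 0ℚ
        χ-new = begin
          χ ψ (powU (ℤ.- e) · (k · g))                      ≈⟨ χ-· ψ (powU (ℤ.- e)) (k · g) (Γ₀2-powU (ℤ.- e)) (Γ₀2-· k g Γk Γg) ⟩
          χ ψ (powU (ℤ.- e)) ℚ.+ χ ψ (k · g)               ≈⟨ +-cong (χ-powU-neg ψ e) (χ-· ψ k g Γk Γg) ⟩
          ℚ.- χ ψ (powU e) ℚ.+ (χ ψ k ℚ.+ χ ψ g)           ≈⟨ +-congˡ (ℚ.- χ ψ (powU e)) (+-cong (Ker⇒χ≋0 k Kk) χg≋χUᵉ) ⟩
          ℚ.- χ ψ (powU e) ℚ.+ (0ℚ ℚ.+ χ ψ (powU e))       ≡⟨ cancel (χ ψ (powU e)) ⟩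
          0ℚ                                               ∎
          where
          cancel : ∀ y → ℚ.- y ℚ.+ (0ℚ ℚ.+ y) ≡ 0ℚ
          cancel = solve-∀ ℚ-ring
        new : Intertwines (powU (ℤ.- e) · (k · g)) x (conjV (w ℤ.+ ℤ.- e))
        new = intertwines-· (intertwines-· (intertwines-conj g x (proj₁ Γg)) (Conj⇒Intertwines {conj g x} {conjV w} gx~w))
                            (conjV-shift (ℤ.- e) w)
      base : ∃ λ w → Conj (Ker ψ) V (conjV w)
      base = + 0 , I₂ , Ker-intro I₂ Γ₀2-I (χ-I ψ) , inj₁ refl

    conjV-separated : ∀ i j → Conj (Ker ψ) (conjV i) (conjV j) → i ⊙ χ ψ U ≋ j ⊙ χ ψ U
    conjV-separated i j i~j@(k , Kk@(Γk , _) , _) = ℚ/ℤ.x∙y⁻¹≈ε⇒x≈y (i ⊙ χ ψ U) (j ⊙ χ ψ U) (begin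
      i ⊙ χ ψ U ℚ.+ ℚ.- (j ⊙ χ ψ U)                      ≡⟨ rearrange (i ⊙ χ ψ U) (j ⊙ χ ψ U) ⟩
      ℚ.- (j ⊙ χ ψ U) ℚ.+ (0ℚ ℚ.+ i ⊙ χ ψ U)             ≈⟨ +-cong (neg-cong (χ-powU ψ j)) (+-cong (Ker⇒χ≋0 k Kk) (χ-powU ψ i)) ⟨
      ℚ.- χ ψ (powU j) ℚ.+ (χ ψ k ℚ.+ χ ψ (powU i))      ≈⟨ +-cong (χ-powU-neg ψ j) (χ-· ψ k (powU i) Γk (Γ₀2-powU i)) ⟨
      χ ψ (powU (ℤ.- j)) ℚ.+ χ ψ (k · powU i)            ≈⟨ χ-· ψ (powU (ℤ.- j)) (k · powU i) (Γ₀2-powU (ℤ.- j)) ΓkUⁱ ⟨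
      χ ψ M                                              ≈⟨ χM≋0 (V-centralizer M (proj₁ ΓM) (intertwining M-central)) ⟩
      0ℚ                                                 ∎)
      where
      M : M₂
      M = powU (ℤ.- j) · (k · powU i)
      ΓM : Γ₀2 M
      ΓkUⁱ : Γ₀2 (k · powU i)
      ΓkUⁱ = Γ₀2-· k (powU i) Γk (Γ₀2-powU i)
      ΓM = Γ₀2-· (powU (ℤ.- j)) (k · powU i) (Γ₀2-powU (ℤ.- j)) ΓkUⁱ
      M-central : Intertwines M V V
      M-central = intertwines-· (intertwines-· (powU-intertwines-V i) (Conj⇒Intertwines {conjV i} {conjV j} i~j))
                                (powU-intertwines-conjV j)
      χM≋0 : M ≅ I₂ ⊎ M ≅ V → χ ψ M ≋ 0ℚ
      χM≋0 (inj₁ M≅I) = ≋-trans (χ-cong ψ ΓM M≅I) (χ-I ψ)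
      χM≋0 (inj₂ M≅V) = ≋-trans (χ-cong ψ ΓM M≅V) χV≋0
      rearrange : ∀ x y → x ℚ.+ ℚ.- y ≡ ℚ.- y ℚ.+ (0ℚ ℚ.+ x)
      rearrange = solve-∀ ℚ-ring

InvClasses-cong : ∀ {P Q : Subset} {m} → (∀ x → P x → Q x) → (∀ x → Q x → P x) → InvClasses P m → InvClasses Q m
InvClasses-cong P⊆Q Q⊆P (r , involution , distinct , cover) =
  r ,
  (λ i → let (Pr , r≉I , r²≈I) = involution i in P⊆Q _ Pr , r≉I , r²≈I) ,
  (λ i j i≢j (k , Qk , k-conj) → distinct i j i≢j (k , Q⊆P k Qk , k-conj)) ,
  (λ x (Qx , x≉I , x²≈I) → let (i , k , Pk , k-conj) = cover x (Q⊆P x Qx , x≉I , x²≈I) in i , k , P⊆Q k Pk , k-conj)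

Ker-InvClasses : ∀ ψ m → χ ψ V ≋ 0ℚ → PrimitiveRoot m (χ ψ U) → InvClasses (Ker ψ) m
Ker-InvClasses ψ m χV≋0 prim@(1≤m , m-int , _) =
  representative , (λ i → conjV-Involution ψ χV≋0 (+ toℕ i)) , distinct , cover
  where
  representative : Fin m → M₂
  representative i = conjV (+ toℕ i)
  distinct : ∀ i j → i ≢ j → ¬ Conj (Ker ψ) (representative i) (representative j)
  distinct i j i≢j i~j = i≢j (FinP.toℕ-injective
    (PrimitiveRoot-injective prim (FinP.toℕ<n i) (FinP.toℕ<n j) (conjV-separated ψ χV≋0 (+ toℕ i) (+ toℕ j) i~j)))
  cover : ∀ x → Involution (Ker ψ) x → ∃ λ i → Conj (Ker ψ) x (representative i)
  cover x (Kx , x≉I , x²≈I) = reduce {proj₁ w,x~w} (proj₂ w,x~w)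
    where
    instance
      m≢0 : ℕ.NonZero m
      m≢0 = ℕ.>-nonZero 1≤m
    w,x~w : ∃ λ w → Conj (Ker ψ) x (conjV w)
    w,x~w = Conj-conjV ψ χV≋0 x (proj₁ Kx , x≉I , x²≈I)
    reduce : ∀ {w} → Conj (Ker ψ) x (conjV w) → ∃ λ i → Conj (Ker ψ) x (representative i)
    reduce {w} x~w = fromℕ< r<m ,
      subst (λ r → Conj (Ker ψ) x (conjV (+ r))) (sym (FinP.toℕ-fromℕ< r<m))
        (Conj-trans ψ {x} {conjV w} {conjV (+ (w ℤDM.%ℕ m))} x~w (conjV-mod ψ m m-int w))
      where
      r<m : w ℤDM.%ℕ m ℕ.< m
      r<m = ℤDM.n%ℕd<d w m

-- The three subgroups of the theorem as kernels of characters

·V·V : ∀ x → (x · V) · V ≡ neg x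
·V·V x = trans (·-assoc x V V) (trans (·-negʳ x I₂) (cong neg (·-identityʳ x)))

≈·V·V : ∀ x → x ≈ ((x · V) · V)
≈·V·V x = inj₂ (sym (trans (cong neg (·V·V x)) (neg-involutive x)))

withV⊆Ker : ∀ ψ {K : Subset} → (∀ h → K h → Ker ψ h) → Ker ψ V → ∀ x → withV K x → Ker ψ x
withV⊆Ker ψ K⊆Ker KV x (h , Kh , inj₁ x≈h) = Ker-resp ψ (K⊆Ker h Kh) (≅-sym ⟪ x≈h ⟫)
withV⊆Ker ψ K⊆Ker KV x (h , Kh , inj₂ x≈hV) = Ker-resp ψ (Ker-· ψ h V (K⊆Ker h Kh) KV) (≅-sym ⟪ x≈hV ⟫)

trivialCharacter : Character
trivialCharacter = record { χ = λ _ → 0ℚ ; resp = λ _ _ _ _ → refl ; hom = λ _ _ _ _ → refl }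

Γ₀2-InvClasses : InvClasses Γ₀2 1
Γ₀2-InvClasses = InvClasses-cong (λ _ → proj₁) (λ _ Γx → Γx , refl)
  (Ker-InvClasses trivialCharacter 1 (≡⇒≋ refl) (s≤s z≤n , refl , λ { _ (s≤s z≤n) (s≤s ()) }))

module _ (ψ : Character) where
  open import Relation.Binary.Reasoning.Setoid ℚ/ℤ.setoid

  private
    exchange : ∀ p q r s → (p ℚ.+ q) ℚ.+ (r ℚ.+ s) ≡ (p ℚ.+ r) ℚ.+ (q ℚ.+ s)
    exchange = solve-∀ ℚ-ring

  parityTwist : Character
  parityTwist = record { χ = χ₁ ; resp = resp₁ ; hom = hom₁ }
    where
    χ₁ : M₂ → ℚ
    χ₁ x = χ ψ x ℚ.+ b x ⊙ χ ψ V
    b-resp : ∀ {x y} → x ≈ y → b x ⊙ χ ψ V ≋ b y ⊙ χ ψ V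
    b-resp (inj₁ refl) = ≡⇒≋ refl
    b-resp {y = y} (inj₂ refl) = ⊙-mod2 (ℤ.- b y) (b y) (χ-V+V ψ) (divides (ℤ.- b y) (double (b y)))
      where
      double : ∀ z → ℤ.- z ℤ.- z ≡ ℤ.- z ℤ.* + 2
      double = solve-∀ ℤ-ring
    resp₁ : ∀ x y → Γ₀2 x → x ≈ y → χ₁ x ~ χ₁ y
    resp₁ x y Γx x≈y = unwrap (+-cong (χ-cong ψ Γx ⟪ x≈y ⟫) (b-resp x≈y))
    hom₁ : ∀ x y → Γ₀2 x → Γ₀2 y → χ₁ (x · y) ~ (χ₁ x ℚ.+ χ₁ y)
    hom₁ x y Γx Γy = unwrap (begin
      χ ψ (x · y) ℚ.+ b (x · y) ⊙ χ ψ V                          ≈⟨ +-cong (χ-· ψ x y Γx Γy)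
                                                                     (⊙-mod2 (b (x · y)) _ (χ-V+V ψ) (b-·-mod2 x y Γx Γy)) ⟩
      (χ ψ x ℚ.+ χ ψ y) ℚ.+ (b x ℤ.+ b y) ⊙ χ ψ V               ≡⟨ cong ((χ ψ x ℚ.+ χ ψ y) ℚ.+_) (⊙-homo-+ (b x) (b y) (χ ψ V)) ⟩
      (χ ψ x ℚ.+ χ ψ y) ℚ.+ (b x ⊙ χ ψ V ℚ.+ b y ⊙ χ ψ V)       ≡⟨ exchange (χ ψ x) (χ ψ y) (b x ⊙ χ ψ V) (b y ⊙ χ ψ V) ⟩
      χ₁ x ℚ.+ χ₁ y                                              ∎)

  parityTwist-U : χ parityTwist U ≋ χ ψ U
  parityTwist-U = ≡⇒≋ (trans (cong (χ ψ U ℚ.+_) (ℚP.*-zeroˡ (χ ψ V))) (ℚP.+-identityʳ (χ ψ U)))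

  parityTwist-V : χ parityTwist V ≋ 0ℚ
  parityTwist-V = ≋-trans (≡⇒≋ (cong (χ ψ V ℚ.+_) (ℚP.*-identityˡ (χ ψ V)))) (χ-V+V ψ)

  H₁⊆Ker : ∀ x → H₁ ψ x → Ker parityTwist x
  H₁⊆Ker = withV⊆Ker parityTwist H₀⊆Ker (Ker-intro parityTwist V Γ₀2-V parityTwist-V)
    where
    H₀⊆Ker : ∀ h → H₀ ψ h → Ker parityTwist h
    H₀⊆Ker h (Kh@(Γh , _) , Γ2h) = Ker-intro parityTwist h Γh (begin
      χ ψ h ℚ.+ b h ⊙ χ ψ V   ≈⟨ +-cong (Ker⇒χ≋0 ψ h Kh) (⊙-even (b h) (χ-V+V ψ) (Γ2⇒Even-b h Γ2h)) ⟩
      0ℚ ℚ.+ 0ℚ               ≡⟨ ℚP.+-identityʳ 0ℚ ⟩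
      0ℚ                      ∎)

  Ker⊆H₁ : ∀ x → Ker parityTwist x → H₁ ψ x
  Ker⊆H₁ x K₁x@(Γx , _) with parity (b x)
  ... | inj₁ 2∣b = x , (Ker-intro ψ x Γx χx≋0 , Γ₀2∧Even-b⇒Γ2 x Γx 2∣b) , inj₁ (inj₁ refl)
    where
    χx≋0 : χ ψ x ≋ 0ℚ
    χx≋0 = begin
      χ ψ x                     ≡⟨ ℚP.+-identityʳ (χ ψ x) ⟨
      χ ψ x ℚ.+ 0ℚ              ≈⟨ +-congˡ (χ ψ x) (⊙-even (b x) (χ-V+V ψ) 2∣b) ⟨
      χ ψ x ℚ.+ b x ⊙ χ ψ V     ≈⟨ Ker⇒χ≋0 parityTwist x K₁x ⟩
      0ℚ                        ∎
  ... | inj₂ b-odd = x · V , (Ker-intro ψ (x · V) ΓxV χxV≋0 , Γ₀2∧Even-b⇒Γ2 (x · V) ΓxV 2∣bxV) , inj₂ (≈·V·V x)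
    where
    ΓxV : Γ₀2 (x · V)
    ΓxV = Γ₀2-· x V Γx Γ₀2-V
    2∣bxV : Even (b (x · V))
    2∣bxV = Even-by (b-·-mod2 x V Γx Γ₀2-V) (Odd⇒Even-suc {b x} b-odd)
    χxV≋0 : χ ψ (x · V) ≋ 0ℚ
    χxV≋0 = begin
      χ ψ (x · V)               ≈⟨ χ-· ψ x V Γx Γ₀2-V ⟩
      χ ψ x ℚ.+ χ ψ V           ≡⟨ cong (χ ψ x ℚ.+_) (ℚP.*-identityˡ (χ ψ V)) ⟨
      χ ψ x ℚ.+ (+ 1) ⊙ χ ψ V   ≈⟨ +-congˡ (χ ψ x) (⊙-mod2 (b x) (+ 1) (χ-V+V ψ) b-odd) ⟨
      χ ψ x ℚ.+ b x ⊙ χ ψ V     ≈⟨ Ker⇒χ≋0 parityTwist x K₁x ⟩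
      0ℚ                        ∎

  H₁-InvClasses : ∀ n → PrimitiveRoot n (χ ψ U) → InvClasses (H₁ ψ) n
  H₁-InvClasses n prim = InvClasses-cong Ker⊆H₁ H₁⊆Ker
    (Ker-InvClasses parityTwist n parityTwist-V (PrimitiveRoot-resp prim (≋-sym parityTwist-U)))

  doubled : Character
  doubled = record { χ = χ₂ ; resp = resp₂ ; hom = hom₂ }
    where
    χ₂ : M₂ → ℚ
    χ₂ x = χ ψ x ℚ.+ χ ψ x
    resp₂ : ∀ x y → Γ₀2 x → x ≈ y → χ₂ x ~ χ₂ y
    resp₂ x y Γx x≈y = unwrap (+-cong (χ-cong ψ Γx ⟪ x≈y ⟫) (χ-cong ψ Γx ⟪ x≈y ⟫))
    hom₂ : ∀ x y → Γ₀2 x → Γ₀2 y → χ₂ (x · y) ~ (χ₂ x ℚ.+ χ₂ y)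
    hom₂ x y Γx Γy = unwrap (≋-trans (+-cong (χ-· ψ x y Γx Γy) (χ-· ψ x y Γx Γy))
                                      (≡⇒≋ (exchange (χ ψ x) (χ ψ y) (χ ψ x) (χ ψ y))))

  H₂⊆Ker : ∀ x → H₂ ψ x → Ker doubled x
  H₂⊆Ker = withV⊆Ker doubled H⊆Ker (Ker-intro doubled V Γ₀2-V (χ-V+V ψ))
    where
    H⊆Ker : ∀ h → H ψ h → Ker doubled h
    H⊆Ker h Kh@(Γh , _) = Ker-intro doubled h Γh
      (≋-trans (+-cong (Ker⇒χ≋0 ψ h Kh) (Ker⇒χ≋0 ψ h Kh)) (≡⇒≋ (ℚP.+-identityʳ 0ℚ)))

  Ker⊆H₂ : χ ψ V ≋ ½ → ∀ x → Ker doubled x → H₂ ψ x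
  Ker⊆H₂ χV≋½ x K₂x@(Γx , _) with 2-torsion (χ ψ x) (Ker⇒χ≋0 doubled x K₂x)
  ... | inj₁ χx≋0 = x , Ker-intro ψ x Γx χx≋0 , inj₁ (inj₁ refl)
  ... | inj₂ χx≋½ = x · V , Ker-intro ψ (x · V) (Γ₀2-· x V Γx Γ₀2-V) χxV≋0 , inj₂ (≈·V·V x)
    where
    χxV≋0 : χ ψ (x · V) ≋ 0ℚ
    χxV≋0 = begin
      χ ψ (x · V)          ≈⟨ χ-· ψ x V Γx Γ₀2-V ⟩
      χ ψ x ℚ.+ χ ψ V      ≈⟨ +-cong χx≋½ χV≋½ ⟩
      ½ ℚ.+ ½              ≈⟨ IsInt⇒≋0 refl ⟩
      0ℚ                   ∎

  H₂-InvClasses : ∀ n → PrimitiveRoot n (χ ψ U) → χ ψ V ≋ ½ → 2 ∣ n → InvClasses (H₂ ψ) (n / 2)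
  H₂-InvClasses .(k ℕ.* 2) prim χV≋½ (Data.Nat.Divisibility.divides k refl) =
    subst (InvClasses (H₂ ψ)) (sym (Data.Nat.DivMod.m*n/n≡m k 2))
      (InvClasses-cong (Ker⊆H₂ χV≋½) H₂⊆Ker (Ker-InvClasses doubled k (χ-V+V ψ) (PrimitiveRoot-double k (χ ψ U) prim)))

lemma3p4 : InvClasses Γ₀2 1
    × ((n : ℕ) (ψ : Character) (ε : Sign)
       → PrimitiveRoot n (χ ψ U)
       → χ ψ V ~ signQ ε
       → InvClasses (H₁ ψ) n
         × (2 ∣ n → ε ≡ Sign.- → InvClasses (H₂ ψ) (n / 2)))
lemma3p4 = Γ₀2-InvClasses , λ n ψ ε prim χV~ε →
  H₁-InvClasses ψ n prim , λ { 2∣n refl → H₂-InvClasses ψ n prim ⟨ χV~ε ⟩ 2∣n }
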